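{- Let $\lambda$ be a nonzero real number and $\alpha$ a nonzero complex number. For every integer $n\ge1$, $$\mathcal{E}_{n,\lambda}^{(\alpha)}=\sum_{k=1}^{n}(-\alpha)_{k}\Big(\frac{1}{2}\Big)^{k}B_{n,k}\big((1)_{1,\lambda},(1)_{2,\lambda},\dots,(1)_{n-k+1,\lambda}\big)=\sum_{k=1}^{n}(-\alpha)_{k}\Big(\frac{1}{2}\Big)^{k}S_{2,\lambda}(n,k).$$
   Context: For nonzero real $\lambda$: $(x)_{0,\lambda}=1$, $(x)_{n,\lambda}=x(x-\lambda)\cdots(x-(n-1)\lambda)$; $e_\lambda^x(t)=(1+\lambda t)^{x/\lambda}=\sum_{n\ge0}(x)_{n,\lambda}\frac{t^n}{n!}$, $e_\lambda(t)=e_\lambda^1(t)$. For complex $y$, $(y)_0=1$, $(y)_k=y(y-1)\cdots(y-k+1)$. The degenerate Euler numbers of order $\alpha$ are defined by $\Big(\frac{2}{e_{\lambda}(t)+1}\Big)^{\alpha}=\sum_{n\ge0}\mathcal{E}_{n,\lambda}^{(\alpha)}\frac{t^{n}}{n!}$. The degenerate Stirling numbers of the second kind $S_{2,\lambda}(n,k)$ are defined by $(x)_{n,\lambda}=\sum_{k=0}^{n}S_{2,\lambda}(n,k)(x)_{k}$ (equivalently $\frac{1}{k!}(e_\lambda(t)-1)^k=\sum_{n\ge k}S_{2,\lambda}(n,k)\frac{t^n}{n!}$). The incomplete Bell polynomials are $B_{n,k}(x_{1},\dots,x_{n-k+1})=\sum\frac{n!}{l_{1}!\cdots l_{n-k+1}!}\prod_{i}\big(\frac{x_{i}}{i!}\big)^{l_{i}}$,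 the sum over nonnegative integers $l_1,\dots,l_{n-k+1}$ with $\sum l_i=k$ and $\sum i\,l_i=n$; equivalently $\frac{1}{k!}\big(\sum_{i\ge1}x_i\frac{t^i}{i!}\big)^k=\sum_{n\ge k}B_{n,k}(x_1,\dots,x_{n-k+1})\frac{t^n}{n!}$. -}

module Defs where

open import Level using (_⊔_)
open import Algebra.Bundles using (CommutativeRing)
open import Data.Nat as ℕ using (ℕ; zero; suc; _∸_; _≡ᵇ_)
open import Data.Nat using (_!)
open import Data.Bool using (Bool; true; false; if_then_else_; _∧_)
open import Data.List using (List; []; _∷_; map; concatMap; upTo; filter; foldr)
open import Data.Product using (∃)
open import Relation.Nullary using (¬_)
open import Relation.Unary using (Pred)
open import Relation.Nullary.Decidable using (yes; no)
open import Data.Bool using (T)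
open import Data.Bool.Properties using (T?)

module _ {c ℓ} (R : CommutativeRing c ℓ) where
  open CommutativeRing R

  fromℕ : ℕ → Carrier
  fromℕ zero    = 0#
  fromℕ (suc n) = 1# + fromℕ n

  record IsCharZeroField : Set (c ⊔ ℓ) where
    field
      1≉0      : ¬ (1# ≈ 0#)
      inverse  : ∀ x → ¬ (x ≈ 0#) → ∃ λ y → x * y ≈ 1#
      charZero : ∀ n → ¬ (fromℕ (suc n) ≈ 0#)

module _ {c ℓ} (R : CommutativeRing c ℓ) (F : IsCharZeroField R) where
  open CommutativeRing R
  open IsCharZeroField F

  _−_ : Carrier → Carrier → Carrier
  x − y = x + (- y)

  _^ᴿ_ : Carrier → ℕ → Carrier
  x ^ᴿ zero  = 1#
  x ^ᴿ suc n = (x ^ᴿ n) * x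

  inv1+ : ℕ → Carrier
  inv1+ n = Data.Product.proj₁ (inverse (fromℕ R (suc n)) (charZero n))

  invFact : ℕ → Carrier
  invFact zero    = 1#
  invFact (suc k) = invFact k * inv1+ k

  sumTo : ℕ → (ℕ → Carrier) → Carrier
  sumTo zero    f = f 0
  sumTo (suc n) f = sumTo n f + f (suc n)

  sum1To : ℕ → (ℕ → Carrier) → Carrier
  sum1To zero    f = 0#
  sum1To (suc n) f = sum1To n f + f (suc n)

  sumList : List Carrier → Carrier
  sumList = foldr _+_ 0#

  degFall : Carrier → Carrier → ℕ → Carrier
  degFall x lam zero    = 1#
  degFall x lam (suc n) = degFall x lam n * (x − (fromℕ R n * lam))

  fall : Carrier → ℕ → Carrier
  fall y zero    = 1#
  fall y (suc k) = fall y k * (y − fromℕ R k)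

  -- Formal power series: ordinary coefficient sequences  f n = [t^n] f
  Series : Set c
  Series = ℕ → Carrier

  oneS : Series
  oneS zero    = 1#
  oneS (suc _) = 0#

  _⊕_ : Series → Series → Series
  (f ⊕ g) n = f n + g n

  _⊖_ : Series → Series → Series
  (f ⊖ g) n = f n − g n

  scale : Carrier → Series → Series
  scale a f n = a * f n

  _⊛_ : Series → Series → Series
  (f ⊛ g) n = sumTo n (λ k → f k * g (n ∸ k))

  powS : Series → ℕ → Series
  powS f zero    = oneS
  powS f (suc k) = powS f k ⊛ f

  -- reciprocal of a series f, given c' = (f 0)⁻¹:
  -- g 0 = c',  g n = - c' * Σ_{k=1}^{n} f k * g (n - k)
  private
    recipUpTo : Series → Carrier → ℕ → Series
    recipUpTo f c' zero    = λ _ → c'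
    recipUpTo f c' (suc n) m with m ℕ.≤ᵇ n
    ... | true  = recipUpTo f c' n m
    ... | false = - (c' * sum1To (suc n) (λ k → f k * recipUpTo f c' n (suc n ∸ k)))

  recipS : Series → Carrier → Series
  recipS f c' n = recipUpTo f c' n n

  logS : Series → Series
  logS f n = sum1To n (λ k → ((- 1#) ^ᴿ suc k) * inv1+ (k ∸ 1) * powS (f ⊖ oneS) k n)

  expS : Series → Series
  expS v n = sumTo n (λ k → invFact k * powS v k n)

  powC : Series → Carrier → Series
  powC f a = expS (scale a (logS f))

  eλ : Carrier → Series
  eλ lam n = degFall 1# lam n * invFact n

  -- 2 / (e_λ(t) + 1)   (the constant term of e_λ(t)+1 is 2, with inverse 1/2)
  twoOverEPlus1 : Carrier → Series
  twoOverEPlus1 lam = scale (fromℕ R 2) (recipS (eλ lam ⊕ oneS) (inv1+ 1))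

  degEuler : Carrier → Carrier → ℕ → Carrier
  degEuler lam α n = fromℕ R (n !) * powC (twoOverEPlus1 lam) α n

  S2λ : Carrier → ℕ → ℕ → Carrier
  S2λ lam n k = fromℕ R (n !) * (invFact k * powS (eλ lam ⊖ oneS) k n)

  -- incomplete Bell polynomials B_{n,k}(x_1, …, x_{n-k+1})
  -- (x given as a function, x i = x_i for 1 ≤ i ≤ n-k+1)
  -- all lists of length m with entries in {0,…,b}
  tuples : ℕ → ℕ → List (List ℕ)
  tuples zero    b = [] ∷ []
  tuples (suc m) b = concatMap (λ l → map (l ∷_) (tuples m b)) (upTo (suc b))

  sumℕ : List ℕ → ℕ
  sumℕ = foldr ℕ._+_ 0

  wsum : ℕ → List ℕ → ℕ
  wsum i []       = 0
  wsum i (l ∷ ls) = i ℕ.* l ℕ.+ wsum (suc i) ls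

  bellProd : (ℕ → Carrier) → ℕ → List ℕ → Carrier
  bellProd x i []       = 1#
  bellProd x i (l ∷ ls) = (invFact l * ((x i * invFact i) ^ᴿ l)) * bellProd x (suc i) ls

  admissible : ℕ → ℕ → List ℕ → Bool
  admissible n k ls = (sumℕ ls ≡ᵇ k) ∧ (wsum 1 ls ≡ᵇ n)

  bellB : ℕ → ℕ → (ℕ → Carrier) → Carrier
  bellB n k x =
    sumList (map (λ ls → fromℕ R (n !) * bellProd x 1 ls)
                 (filter (λ ls → T? (admissible n k ls)) (tuples (suc (n ∸ k)) k)))

module Submission where

-- The generating function (2/(e_λ(t)+1))^α is (1 + u)^(-α) for u = (e_λ(t) - 1)/2, a series without
-- constant term.  Differentiating exp and log shows that P = (2/(e_λ(t)+1))^α satisfies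
-- (1 + u) P′ = -α P u′ with P(0) = 1.  The truncations Σ_{k≤N} (-α)_k u^k/k! satisfy this equation up to
-- an error of order t^(N+1), and the equation determines a series from its constant term one coefficient
-- at a time, so the n-th coefficient of P is that of Σ_{k≤n} (-α)_k (1/2)^k (e_λ(t) - 1)^k/k!.  This is the
-- Stirling form.  For the Bell form, (e_λ(t) - 1)^k/k! is the exponential generating function of
-- B_{n,k}((1)_{1,λ}, (1)_{2,λ}, …): splitting off the first variable of the Bell sum matches one step of
-- the binomial theorem (A + B)^K/K! = Σ_l (A^l/l!)(B^(K-l)/(K-l)!).

open import Defs
open import Level using (Level)
open import Algebra.Bundles using (CommutativeRing)
open import Data.Nat as ℕ using (ℕ; zero; suc; _≤_; _<_; _∸_; z≤n; s≤s)
import Data.Nat.Properties as ℕₚ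
open import Data.Integer as ℤ using (ℤ; +_; -[1+_])
import Data.Integer.Properties as ℤₚ
open import Data.Sign as Sign using ()
open import Data.Maybe using (Maybe; just; nothing)
open import Data.Sum using (inj₁; inj₂)
open import Data.Product using (_×_; _,_; proj₂)
open import Relation.Nullary using (¬_; yes; no)
open import Relation.Binary.PropositionalEquality as ≡ using (_≡_; _≢_)
import Relation.Binary.Reasoning.Setoid as SetoidReasoning
import Algebra.Solver.Ring
open import Algebra.Solver.Ring.AlmostCommutativeRing
  using (fromCommutativeRing; _-Raw-AlmostCommutative⟶_)

-- A ring solver with integer coefficients: unlike coefficients taken from R itself, these compute, so
-- cancellations such as x - x = 0 are found by normalisation.
module IntegerCoefficients {c ℓ} (R : CommutativeRing c ℓ) where
  open CommutativeRing R
  open SetoidReasoning setoid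
  open import Algebra.Properties.Ring ring
    using (-‿distribˡ-*; -‿distribʳ-*; -‿involutive; -0#≈0#; -‿anti-homo-+)
  open import Algebra.Properties.CommutativeSemigroup +-commutativeSemigroup
    using (interchange)
  open import Algebra.Properties.Semiring.Mult.TCOptimised semiring
    using (×-homo-+; ×1-homo-*) renaming (_×_ to _×′_)

  fromℕ-+ : ∀ m n → fromℕ R (m ℕ.+ n) ≈ fromℕ R m + fromℕ R n
  fromℕ-+ zero    n = sym (+-identityˡ _)
  fromℕ-+ (suc m) n = trans (+-congˡ (fromℕ-+ m n)) (sym (+-assoc _ _ _))

  fromℕ≈×1 : ∀ n → fromℕ R n ≈ n ×′ 1#
  fromℕ≈×1 zero    = refl
  fromℕ≈×1 (suc n) = trans (+-congˡ (fromℕ≈×1 n)) (sym (×-homo-+ 1# 1 n))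

  -- With the optimised _×′_, fromℤ (+ 1) reduces to 1#, so the solver constant con (+ 1) is 1# on the nose.
  fromℤ : ℤ → Carrier
  fromℤ (+ n)    = n ×′ 1#
  fromℤ -[1+ n ] = - (suc n ×′ 1#)

  fromℤ-⊖ : ∀ m n → fromℤ (m ℤ.⊖ n) ≈ m ×′ 1# + - (n ×′ 1#)
  fromℤ-⊖ zero    zero    = sym (trans (+-identityˡ _) -0#≈0#)
  fromℤ-⊖ zero    (suc n) = sym (+-identityˡ _)
  fromℤ-⊖ (suc m) zero    = sym (trans (+-congˡ -0#≈0#) (+-identityʳ _))
  fromℤ-⊖ (suc m) (suc n) = begin
    fromℤ (suc m ℤ.⊖ suc n)                   ≡⟨ ≡.cong fromℤ (ℤₚ.[1+m]⊖[1+n]≡m⊖n m n) ⟩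
    fromℤ (m ℤ.⊖ n)                           ≈⟨ fromℤ-⊖ m n ⟩
    m ×′ 1# + - (n ×′ 1#)                       ≈⟨ +-identityˡ _ ⟨
    0# + (m ×′ 1# + - (n ×′ 1#))                ≈⟨ +-congʳ (-‿inverseʳ 1#) ⟨
    (1# + - 1#) + (m ×′ 1# + - (n ×′ 1#))       ≈⟨ interchange _ _ _ _ ⟩
    (1# + m ×′ 1#) + (- 1# + - (n ×′ 1#))       ≈⟨ +-congˡ (trans (-‿anti-homo-+ _ _) (+-comm _ _)) ⟨
    (1# + m ×′ 1#) + - (1# + n ×′ 1#)           ≈⟨ +-cong (×-homo-+ 1# 1 m) (-‿cong (×-homo-+ 1# 1 n)) ⟨
    suc m ×′ 1# + - (suc n ×′ 1#)               ∎

  fromℤ-+ : ∀ i j → fromℤ (i ℤ.+ j) ≈ fromℤ i + fromℤ j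
  fromℤ-+ -[1+ m ] -[1+ n ] = begin
    - (suc (suc (m ℕ.+ n)) ×′ 1#)          ≡⟨ ≡.cong (λ k → - (suc k ×′ 1#)) (ℕₚ.+-suc m n) ⟨
    - ((suc m ℕ.+ suc n) ×′ 1#)            ≈⟨ -‿cong (×-homo-+ 1# (suc m) (suc n)) ⟩
    - (suc m ×′ 1# + suc n ×′ 1#)           ≈⟨ -‿anti-homo-+ _ _ ⟩
    - (suc n ×′ 1#) + - (suc m ×′ 1#)       ≈⟨ +-comm _ _ ⟩
    - (suc m ×′ 1#) + - (suc n ×′ 1#)       ∎
  fromℤ-+ -[1+ m ] (+ n)    = trans (fromℤ-⊖ n (suc m)) (+-comm _ _)
  fromℤ-+ (+ m)    -[1+ n ] = fromℤ-⊖ m (suc n)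
  fromℤ-+ (+ m)    (+ n)    = ×-homo-+ 1# m n

  fromℤ-+◃ : ∀ n → fromℤ (Sign.+ ℤ.◃ n) ≈ n ×′ 1#
  fromℤ-+◃ zero    = refl
  fromℤ-+◃ (suc n) = refl

  fromℤ--◃ : ∀ n → fromℤ (Sign.- ℤ.◃ n) ≈ - (n ×′ 1#)
  fromℤ--◃ zero    = sym -0#≈0#
  fromℤ--◃ (suc n) = refl

  fromℤ-* : ∀ i j → fromℤ (i ℤ.* j) ≈ fromℤ i * fromℤ j
  fromℤ-* (+ m)    (+ n)    = trans (fromℤ-+◃ (m ℕ.* n)) (×1-homo-* m n)
  fromℤ-* (+ m)    -[1+ n ] = begin
    fromℤ (Sign.- ℤ.◃ (m ℕ.* suc n))  ≈⟨ fromℤ--◃ (m ℕ.* suc n) ⟩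
    - ((m ℕ.* suc n) ×′ 1#)            ≈⟨ -‿cong (×1-homo-* m (suc n)) ⟩
    - (m ×′ 1# * suc n ×′ 1#)           ≈⟨ -‿distribʳ-* _ _ ⟩
    m ×′ 1# * - (suc n ×′ 1#)           ∎
  fromℤ-* -[1+ m ] (+ n)    = begin
    fromℤ (Sign.- ℤ.◃ (suc m ℕ.* n))  ≈⟨ fromℤ--◃ (suc m ℕ.* n) ⟩
    - ((suc m ℕ.* n) ×′ 1#)            ≈⟨ -‿cong (×1-homo-* (suc m) n) ⟩
    - (suc m ×′ 1# * n ×′ 1#)           ≈⟨ -‿distribˡ-* _ _ ⟩
    - (suc m ×′ 1#) * n ×′ 1#           ∎
  fromℤ-* -[1+ m ] -[1+ n ] = begin
    fromℤ (Sign.+ ℤ.◃ (suc m ℕ.* suc n))     ≈⟨ fromℤ-+◃ (suc m ℕ.* suc n) ⟩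
    (suc m ℕ.* suc n) ×′ 1#                   ≈⟨ ×1-homo-* (suc m) (suc n) ⟩
    suc m ×′ 1# * suc n ×′ 1#                  ≈⟨ -‿involutive _ ⟨
    - - (suc m ×′ 1# * suc n ×′ 1#)            ≈⟨ -‿cong (-‿distribˡ-* _ _) ⟩
    - (- (suc m ×′ 1#) * suc n ×′ 1#)          ≈⟨ -‿distribʳ-* _ _ ⟩
    - (suc m ×′ 1#) * - (suc n ×′ 1#)          ∎

  fromℤ-neg : ∀ i → fromℤ (ℤ.- i) ≈ - fromℤ i
  fromℤ-neg (+ zero)  = sym -0#≈0#
  fromℤ-neg (+ suc n) = refl
  fromℤ-neg -[1+ n ]  = sym (-‿involutive _)

  fromℤ-homomorphism : ℤ.+-*-rawRing -Raw-AlmostCommutative⟶ fromCommutativeRing R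
  fromℤ-homomorphism = record
    { ⟦_⟧    = fromℤ
    ; +-homo = fromℤ-+
    ; *-homo = fromℤ-*
    ; -‿homo = fromℤ-neg
    ; 0-homo = refl
    ; 1-homo = refl
    }

  fromℤ-≟ : ∀ i j → Maybe (fromℤ i ≈ fromℤ j)
  fromℤ-≟ i j with i ℤ.≟ j
  ... | yes ≡.refl = just refl
  ... | no _       = nothing

  open Algebra.Solver.Ring ℤ.+-*-rawRing (fromCommutativeRing R) fromℤ-homomorphism fromℤ-≟ public
    using (solve; _:+_; _:*_; :-_; _:-_; con; _:=_)

module FiniteSums {c ℓ} (R : CommutativeRing c ℓ) where
  open CommutativeRing R
  open SetoidReasoning setoid
  open import Algebra.Properties.CommutativeSemigroup +-commutativeSemigroup
    using (interchange)

  Σ₀ : ℕ → (ℕ → Carrier) → Carrier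
  Σ₀ zero    f = f 0
  Σ₀ (suc n) f = Σ₀ n f + f (suc n)

  Σ₁ : ℕ → (ℕ → Carrier) → Carrier
  Σ₁ zero    f = 0#
  Σ₁ (suc n) f = Σ₁ n f + f (suc n)

  Σ₀-cong-≤ : ∀ n {f g} → (∀ k → k ≤ n → f k ≈ g k) → Σ₀ n f ≈ Σ₀ n g
  Σ₀-cong-≤ zero    f≈g = f≈g 0 z≤n
  Σ₀-cong-≤ (suc n) f≈g =
    +-cong (Σ₀-cong-≤ n (λ k k≤n → f≈g k (ℕₚ.m≤n⇒m≤1+n k≤n))) (f≈g (suc n) ℕₚ.≤-refl)

  Σ₀-cong : ∀ n {f g} → (∀ k → f k ≈ g k) → Σ₀ n f ≈ Σ₀ n g
  Σ₀-cong n f≈g = Σ₀-cong-≤ n (λ k _ → f≈g k)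

  Σ₀-+ : ∀ n f g → Σ₀ n (λ k → f k + g k) ≈ Σ₀ n f + Σ₀ n g
  Σ₀-+ zero    f g = refl
  Σ₀-+ (suc n) f g = trans (+-congʳ (Σ₀-+ n f g)) (interchange _ _ _ _)

  *-distribˡ-Σ₀ : ∀ n a f → a * Σ₀ n f ≈ Σ₀ n (λ k → a * f k)
  *-distribˡ-Σ₀ zero    a f = refl
  *-distribˡ-Σ₀ (suc n) a f = trans (distribˡ _ _ _) (+-congʳ (*-distribˡ-Σ₀ n a f))

  *-distribʳ-Σ₀ : ∀ n a f → Σ₀ n f * a ≈ Σ₀ n (λ k → f k * a)
  *-distribʳ-Σ₀ zero    a f = refl
  *-distribʳ-Σ₀ (suc n) a f = trans (distribʳ _ _ _) (+-congʳ (*-distribʳ-Σ₀ n a f))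

  Σ₀-zero : ∀ n {f} → (∀ k → k ≤ n → f k ≈ 0#) → Σ₀ n f ≈ 0#
  Σ₀-zero zero    f≈0 = f≈0 0 z≤n
  Σ₀-zero (suc n) f≈0 = trans
    (+-cong (Σ₀-zero n (λ k k≤n → f≈0 k (ℕₚ.m≤n⇒m≤1+n k≤n))) (f≈0 (suc n) ℕₚ.≤-refl))
    (+-identityʳ 0#)

  Σ₀-head : ∀ n f → Σ₀ (suc n) f ≈ f 0 + Σ₀ n (λ k → f (suc k))
  Σ₀-head zero    f = refl
  Σ₀-head (suc n) f = trans (+-congʳ (Σ₀-head n f)) (+-assoc _ _ _)

  Σ₀≈head+Σ₁ : ∀ n f → Σ₀ n f ≈ f 0 + Σ₁ n f
  Σ₀≈head+Σ₁ zero    f = sym (+-identityʳ _)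
  Σ₀≈head+Σ₁ (suc n) f = trans (+-congʳ (Σ₀≈head+Σ₁ n f)) (+-assoc _ _ _)

  Σ₀-reverse : ∀ n f → Σ₀ n f ≈ Σ₀ n (λ k → f (n ∸ k))
  Σ₀-reverse zero    f = refl
  Σ₀-reverse (suc n) f = begin
    Σ₀ (suc n) f                         ≈⟨ Σ₀-head n f ⟩
    f 0 + Σ₀ n (λ k → f (suc k))         ≈⟨ +-congˡ (Σ₀-reverse n (λ k → f (suc k))) ⟩
    f 0 + Σ₀ n (λ k → f (suc (n ∸ k)))   ≈⟨ +-comm _ _ ⟩
    Σ₀ n (λ k → f (suc (n ∸ k))) + f 0   ≈⟨ +-cong (Σ₀-cong-≤ n λ k k≤n →
                                                      reflexive (≡.cong f (≡.sym (ℕₚ.+-∸-assoc 1 k≤n))))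
                                                   (reflexive (≡.cong f (≡.sym (ℕₚ.n∸n≡0 n)))) ⟩
    Σ₀ (suc n) (λ k → f (suc n ∸ k))     ∎

  Σ₀-triangle : ∀ n (G : ℕ → ℕ → Carrier) →
                Σ₀ n (λ i → Σ₀ i (λ a → G a i)) ≈ Σ₀ n (λ a → Σ₀ (n ∸ a) (λ b → G a (a ℕ.+ b)))
  Σ₀-triangle zero    G = refl
  Σ₀-triangle (suc n) G = begin
    Σ₀ n (λ i → Σ₀ i (λ a → G a i)) + (Σ₀ n (λ a → G a (suc n)) + G (suc n) (suc n))
      ≈⟨ +-congʳ (Σ₀-triangle n G) ⟩
    Σ₀ n (λ a → Σ₀ (n ∸ a) (λ b → G a (a ℕ.+ b))) + (Σ₀ n (λ a → G a (suc n)) + G (suc n) (suc n))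
      ≈⟨ +-assoc _ _ _ ⟨
    (Σ₀ n (λ a → Σ₀ (n ∸ a) (λ b → G a (a ℕ.+ b))) + Σ₀ n (λ a → G a (suc n))) + G (suc n) (suc n)
      ≈⟨ +-cong (Σ₀-+ n _ _) (reflexive (≡.cong (G (suc n)) (ℕₚ.+-identityʳ (suc n)))) ⟨
    Σ₀ n (λ a → Σ₀ (n ∸ a) (λ b → G a (a ℕ.+ b)) + G a (suc n)) + G (suc n) (suc n ℕ.+ 0)
      ≈⟨ +-congʳ (Σ₀-cong-≤ n λ a a≤n → trans
           (+-congˡ (reflexive (≡.cong (G a) (last a a≤n))))
           (reflexive (≡.cong (λ m → Σ₀ m (λ b → G a (a ℕ.+ b))) (≡.sym (ℕₚ.+-∸-assoc 1 a≤n))))) ⟩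
    Σ₀ n (λ a → Σ₀ (suc n ∸ a) (λ b → G a (a ℕ.+ b))) + G (suc n) (suc n ℕ.+ 0)
      ≡⟨ ≡.cong (λ m → Σ₀ n (λ a → Σ₀ (suc n ∸ a) (λ b → G a (a ℕ.+ b))) + Σ₀ m (λ b → G (suc n) (suc n ℕ.+ b)))
                (ℕₚ.n∸n≡0 n) ⟨
    Σ₀ (suc n) (λ a → Σ₀ (suc n ∸ a) (λ b → G a (a ℕ.+ b))) ∎
    where
    last : ∀ a → a ≤ n → suc n ≡ a ℕ.+ suc (n ∸ a)
    last a a≤n = ≡.trans (≡.cong suc (≡.sym (ℕₚ.m+[n∸m]≡n a≤n))) (≡.sym (ℕₚ.+-suc a (n ∸ a)))

  Σ₀-extend : ∀ m N {f} → m ≤ N → (∀ k → m < k → k ≤ N → f k ≈ 0#) → Σ₀ N f ≈ Σ₀ m f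
  Σ₀-extend m zero    z≤n f≈0 = refl
  Σ₀-extend m (suc N) m≤N f≈0 with ℕₚ.m≤n⇒m<n∨m≡n m≤N
  ... | inj₂ ≡.refl = refl
  ... | inj₁ m<1+N  = trans
    (+-cong (Σ₀-extend m N (ℕₚ.≤-pred m<1+N) (λ k m<k k≤N → f≈0 k m<k (ℕₚ.m≤n⇒m≤1+n k≤N)))
            (f≈0 (suc N) m<1+N ℕₚ.≤-refl))
    (+-identityʳ _)

  Σ₁-cong-< : ∀ n {f g} → (∀ k → k < n → f (suc k) ≈ g (suc k)) → Σ₁ n f ≈ Σ₁ n g
  Σ₁-cong-< zero    f≈g = refl
  Σ₁-cong-< (suc n) f≈g =
    +-cong (Σ₁-cong-< n (λ k k<n → f≈g k (ℕₚ.m≤n⇒m≤1+n k<n))) (f≈g n ℕₚ.≤-refl)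

  *-distribʳ-Σ₁ : ∀ n a f → Σ₁ n f * a ≈ Σ₁ n (λ k → f k * a)
  *-distribʳ-Σ₁ zero    a f = zeroˡ a
  *-distribʳ-Σ₁ (suc n) a f = trans (distribʳ _ _ _) (+-congʳ (*-distribʳ-Σ₁ n a f))

  Σ₁-extend : ∀ m N {f} → m ≤ N → (∀ k → m < k → k ≤ N → f k ≈ 0#) → Σ₁ N f ≈ Σ₁ m f
  Σ₁-extend m N {f} m≤N f≈0 = ∙-cancelˡ (f 0) (Σ₁ N f) (Σ₁ m f)
    (trans (sym (Σ₀≈head+Σ₁ N f)) (trans (Σ₀-extend m N m≤N f≈0) (Σ₀≈head+Σ₁ m f)))
    where open import Algebra.Properties.Group +-group using (∙-cancelˡ)

module PowerSeries {c ℓ} (R : CommutativeRing c ℓ) (F : IsCharZeroField R) where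
  open CommutativeRing R hiding (zero)
  open FiniteSums R
  open import Relation.Binary.Structures using (IsEquivalence)
  open import Algebra.Properties.Ring ring using (-0#≈0#)

  infix  4 _≋_
  infixl 6 _+ₛ_
  infixl 7 _*ₛ_
  infix  8 -ₛ_

  record _≋_ (f g : Series R F) : Set ℓ where
    constructor coeffwise
    field coeff≈ : ∀ n → f n ≈ g n
  open _≋_ public

  _+ₛ_ : Series R F → Series R F → Series R F
  _+ₛ_ = _⊕_ R F

  _*ₛ_ : Series R F → Series R F → Series R F
  _*ₛ_ = _⊛_ R F

  -ₛ_ : Series R F → Series R F
  (-ₛ f) n = - f n

  0ₛ : Series R F
  0ₛ _ = 0#

  1ₛ : Series R F
  1ₛ = oneS R F

  sumTo≡Σ₀ : ∀ n f → sumTo R F n f ≡ Σ₀ n f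
  sumTo≡Σ₀ zero    f = ≡.refl
  sumTo≡Σ₀ (suc n) f = ≡.cong (_+ f (suc n)) (sumTo≡Σ₀ n f)

  sum1To≡Σ₁ : ∀ n f → sum1To R F n f ≡ Σ₁ n f
  sum1To≡Σ₁ zero    f = ≡.refl
  sum1To≡Σ₁ (suc n) f = ≡.cong (_+ f (suc n)) (sum1To≡Σ₁ n f)

  *ₛ-coeff : ∀ f g n → (f *ₛ g) n ≈ Σ₀ n (λ k → f k * g (n ∸ k))
  *ₛ-coeff f g n = reflexive (sumTo≡Σ₀ n _)

  *ₛ-cong-≤ : ∀ {f f′ g g′} n → (∀ i → i ≤ n → f i ≈ f′ i) → (∀ i → i ≤ n → g i ≈ g′ i) →
              (f *ₛ g) n ≈ (f′ *ₛ g′) n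
  *ₛ-cong-≤ {f} {f′} {g} {g′} n f≈f′ g≈g′ = begin
    (f *ₛ g) n                       ≈⟨ *ₛ-coeff f g n ⟩
    Σ₀ n (λ k → f k * g (n ∸ k))     ≈⟨ Σ₀-cong-≤ n (λ k k≤n →
                                          *-cong (f≈f′ k k≤n) (g≈g′ (n ∸ k) (ℕₚ.m∸n≤m n k))) ⟩
    Σ₀ n (λ k → f′ k * g′ (n ∸ k))   ≈⟨ *ₛ-coeff f′ g′ n ⟨
    (f′ *ₛ g′) n                     ∎
    where open SetoidReasoning setoid

  *ₛ-cong : ∀ {f f′ g g′} → f ≋ f′ → g ≋ g′ → f *ₛ g ≋ f′ *ₛ g′
  *ₛ-cong f≈f′ g≈g′ = coeffwise λ n →
    *ₛ-cong-≤ n (λ i _ → coeff≈ f≈f′ i) (λ i _ → coeff≈ g≈g′ i)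

  *ₛ-congˡ : ∀ h {f g} → f ≋ g → h *ₛ f ≋ h *ₛ g
  *ₛ-congˡ h f≋g = *ₛ-cong {h} {h} (coeffwise λ _ → refl) f≋g

  *ₛ-congʳ : ∀ h {f g} → f ≋ g → f *ₛ h ≋ g *ₛ h
  *ₛ-congʳ h {f} {g} f≋g = *ₛ-cong {f} {g} {h} {h} f≋g (coeffwise λ _ → refl)

  *ₛ-comm : ∀ f g → f *ₛ g ≋ g *ₛ f
  *ₛ-comm f g = coeffwise λ n → begin
    (f *ₛ g) n                                   ≈⟨ *ₛ-coeff f g n ⟩
    Σ₀ n (λ k → f k * g (n ∸ k))                 ≈⟨ Σ₀-reverse n _ ⟩
    Σ₀ n (λ k → f (n ∸ k) * g (n ∸ (n ∸ k)))     ≈⟨ Σ₀-cong-≤ n (λ k k≤n → trans (*-comm _ _)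
                                                       (*-congʳ (reflexive (≡.cong g (ℕₚ.m∸[m∸n]≡n k≤n))))) ⟩
    Σ₀ n (λ k → g k * f (n ∸ k))                 ≈⟨ *ₛ-coeff g f n ⟨
    (g *ₛ f) n                                   ∎
    where open SetoidReasoning setoid

  *ₛ-assoc : ∀ f g h → (f *ₛ g) *ₛ h ≋ f *ₛ (g *ₛ h)
  *ₛ-assoc f g h = coeffwise λ n → begin
    ((f *ₛ g) *ₛ h) n                                          ≈⟨ *ₛ-coeff (f *ₛ g) h n ⟩
    Σ₀ n (λ i → (f *ₛ g) i * h (n ∸ i))                        ≈⟨ Σ₀-cong n (λ i → *-congʳ (*ₛ-coeff f g i)) ⟩
    Σ₀ n (λ i → Σ₀ i (λ a → f a * g (i ∸ a)) * h (n ∸ i))      ≈⟨ Σ₀-cong n (λ i → *-distribʳ-Σ₀ i _ _) ⟩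
    Σ₀ n (λ i → Σ₀ i (λ a → f a * g (i ∸ a) * h (n ∸ i)))      ≈⟨ Σ₀-triangle n _ ⟩
    Σ₀ n (λ a → Σ₀ (n ∸ a) (λ b → f a * g (a ℕ.+ b ∸ a) * h (n ∸ (a ℕ.+ b))))
      ≈⟨ Σ₀-cong n (λ a → Σ₀-cong (n ∸ a) (λ b → trans (*-assoc _ _ _) (*-congˡ (*-cong
           (reflexive (≡.cong g (ℕₚ.m+n∸m≡n a b))) (reflexive (≡.cong h (≡.sym (ℕₚ.∸-+-assoc n a b)))))))) ⟩
    Σ₀ n (λ a → Σ₀ (n ∸ a) (λ b → f a * (g b * h (n ∸ a ∸ b)))) ≈⟨ Σ₀-cong n (λ a → *-distribˡ-Σ₀ (n ∸ a) _ _) ⟨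
    Σ₀ n (λ a → f a * Σ₀ (n ∸ a) (λ b → g b * h (n ∸ a ∸ b)))   ≈⟨ Σ₀-cong n (λ a → *-congˡ (*ₛ-coeff g h (n ∸ a))) ⟨
    Σ₀ n (λ a → f a * (g *ₛ h) (n ∸ a))                         ≈⟨ *ₛ-coeff f (g *ₛ h) n ⟨
    (f *ₛ (g *ₛ h)) n                                           ∎
    where open SetoidReasoning setoid

  *ₛ-distribˡ : ∀ f g h → f *ₛ (g +ₛ h) ≋ f *ₛ g +ₛ f *ₛ h
  *ₛ-distribˡ f g h = coeffwise λ n → begin
    (f *ₛ (g +ₛ h)) n                                              ≈⟨ *ₛ-coeff f (g +ₛ h) n ⟩
    Σ₀ n (λ k → f k * (g (n ∸ k) + h (n ∸ k)))                     ≈⟨ Σ₀-cong n (λ k → distribˡ _ _ _) ⟩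
    Σ₀ n (λ k → f k * g (n ∸ k) + f k * h (n ∸ k))                 ≈⟨ Σ₀-+ n _ _ ⟩
    Σ₀ n (λ k → f k * g (n ∸ k)) + Σ₀ n (λ k → f k * h (n ∸ k))    ≈⟨ +-cong (*ₛ-coeff f g n) (*ₛ-coeff f h n) ⟨
    (f *ₛ g +ₛ f *ₛ h) n                                           ∎
    where open SetoidReasoning setoid

  *ₛ-distribʳ : ∀ f g h → (g +ₛ h) *ₛ f ≋ g *ₛ f +ₛ h *ₛ f
  *ₛ-distribʳ f g h = coeffwise λ n → trans (coeff≈ (*ₛ-comm (g +ₛ h) f) n)
    (trans (coeff≈ (*ₛ-distribˡ f g h) n) (+-cong (coeff≈ (*ₛ-comm f g) n) (coeff≈ (*ₛ-comm f h) n)))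

  *ₛ-identityʳ : ∀ f → f *ₛ 1ₛ ≋ f
  *ₛ-identityʳ f = coeffwise (identityʳ-coeff f)
    where
    identityʳ-coeff : ∀ f n → (f *ₛ 1ₛ) n ≈ f n
    identityʳ-coeff f zero    = *-identityʳ _
    identityʳ-coeff f (suc n) = begin
      (f *ₛ 1ₛ) (suc n)                                           ≈⟨ *ₛ-coeff f 1ₛ (suc n) ⟩
      Σ₀ n (λ k → f k * 1ₛ (suc n ∸ k)) + f (suc n) * 1ₛ (suc n ∸ suc n)
        ≈⟨ +-cong (Σ₀-zero n (λ k k≤n → trans (*-congˡ (reflexive (≡.cong 1ₛ (ℕₚ.+-∸-assoc 1 k≤n)))) (zeroʳ _)))
                  (trans (*-congˡ (reflexive (≡.cong 1ₛ (ℕₚ.n∸n≡0 n)))) (*-identityʳ _)) ⟩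
      0# + f (suc n)                                              ≈⟨ +-identityˡ _ ⟩
      f (suc n)                                                   ∎
      where open SetoidReasoning setoid

  *ₛ-identityˡ : ∀ f → 1ₛ *ₛ f ≋ f
  *ₛ-identityˡ f = coeffwise λ n → trans (coeff≈ (*ₛ-comm 1ₛ f) n) (coeff≈ (*ₛ-identityʳ f) n)

  ≋-isEquivalence : IsEquivalence _≋_
  ≋-isEquivalence = record
    { refl  = coeffwise λ _ → refl
    ; sym   = λ f≋g → coeffwise λ n → sym (coeff≈ f≋g n)
    ; trans = λ f≋g g≋h → coeffwise λ n → trans (coeff≈ f≋g n) (coeff≈ g≋h n)
    }

  seriesRing : CommutativeRing c ℓ
  seriesRing = record
    { Carrier = Series R F ; _≈_ = _≋_ ; _+_ = _+ₛ_ ; _*_ = _*ₛ_ ; -_ = -ₛ_ ; 0# = 0ₛ ; 1# = 1ₛ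
    ; isCommutativeRing = record
      { isRing = record
        { +-isAbelianGroup = record
          { isGroup = record
            { isMonoid = record
              { isSemigroup = record
                { isMagma = record
                  { isEquivalence = ≋-isEquivalence
                  ; ∙-cong        = λ f≋f′ g≋g′ → coeffwise λ n → +-cong (coeff≈ f≋f′ n) (coeff≈ g≋g′ n)
                  }
                ; assoc = λ f g h → coeffwise λ n → +-assoc (f n) (g n) (h n)
                }
              ; identity = (λ f → coeffwise λ n → +-identityˡ (f n)) , (λ f → coeffwise λ n → +-identityʳ (f n))
              }
            ; inverse = (λ f → coeffwise λ n → -‿inverseˡ (f n)) , (λ f → coeffwise λ n → -‿inverseʳ (f n))
            ; ⁻¹-cong = λ f≋g → coeffwise λ n → -‿cong (coeff≈ f≋g n)
            }
          ; comm = λ f g → coeffwise λ n → +-comm (f n) (g n)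
          }
        ; *-cong     = *ₛ-cong
        ; *-assoc    = *ₛ-assoc
        ; *-identity = *ₛ-identityˡ , *ₛ-identityʳ
        ; distrib    = *ₛ-distribˡ , *ₛ-distribʳ
        }
      ; *-comm = *ₛ-comm
      }
    }

  private
    module S  = CommutativeRing seriesRing
    module SΣ = FiniteSums seriesRing

  Σ₀-coeff : ∀ N G m → SΣ.Σ₀ N G m ≈ Σ₀ N (λ k → G k m)
  Σ₀-coeff zero    G m = refl
  Σ₀-coeff (suc N) G m = +-congʳ (Σ₀-coeff N G m)

  Σ₁-coeff : ∀ N G m → SΣ.Σ₁ N G m ≈ Σ₁ N (λ k → G k m)
  Σ₁-coeff zero    G m = refl
  Σ₁-coeff (suc N) G m = +-congʳ (Σ₁-coeff N G m)

  infixr 8 _^ₛ_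

  _^ₛ_ : Series R F → ℕ → Series R F
  _^ₛ_ = powS R F

  constₛ : Carrier → Series R F
  constₛ a zero    = a
  constₛ a (suc n) = 0#

  constₛ-*ₛ : ∀ a f n → (constₛ a *ₛ f) n ≈ a * f n
  constₛ-*ₛ a f zero    = refl
  constₛ-*ₛ a f (suc n) = begin
    (constₛ a *ₛ f) (suc n)                       ≈⟨ *ₛ-coeff (constₛ a) f (suc n) ⟩
    Σ₀ (suc n) (λ k → constₛ a k * f (suc n ∸ k)) ≈⟨ Σ₀-head n _ ⟩
    a * f (suc n) + Σ₀ n (λ k → 0# * f (n ∸ k))    ≈⟨ +-congˡ (Σ₀-zero n (λ k _ → zeroˡ _)) ⟩
    a * f (suc n) + 0#                            ≈⟨ +-identityʳ _ ⟩
    a * f (suc n)                                 ∎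
    where open SetoidReasoning setoid

  scale≋constₛ-*ₛ : ∀ a f → scale R F a f ≋ constₛ a *ₛ f
  scale≋constₛ-*ₛ a f = coeffwise λ n → sym (constₛ-*ₛ a f n)

  constₛ-cong : ∀ {a b} → a ≈ b → constₛ a ≋ constₛ b
  constₛ-cong a≈b = coeffwise λ { zero → a≈b ; (suc n) → refl }

  constₛ-+ : ∀ a b → constₛ a +ₛ constₛ b ≋ constₛ (a + b)
  constₛ-+ a b = coeffwise λ { zero → refl ; (suc n) → +-identityʳ 0# }

  constₛ-* : ∀ a b → constₛ a *ₛ constₛ b ≋ constₛ (a * b)
  constₛ-* a b = coeffwise λ
    { zero    → constₛ-*ₛ a (constₛ b) zero
    ; (suc n) → trans (constₛ-*ₛ a (constₛ b) (suc n)) (zeroʳ a)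
    }

  constₛ-1 : constₛ 1# ≋ 1ₛ
  constₛ-1 = coeffwise λ { zero → refl ; (suc n) → refl }

  constₛ-neg : ∀ a → -ₛ constₛ a ≋ constₛ (- a)
  constₛ-neg a = coeffwise λ { zero → refl ; (suc n) → -0#≈0# }

  ^ₛ-constₛ-*ₛ : ∀ a f k → (constₛ a *ₛ f) ^ₛ k ≋ constₛ (_^ᴿ_ R F a k) *ₛ f ^ₛ k
  ^ₛ-constₛ-*ₛ a f zero    = S.sym (S.trans (*ₛ-congʳ 1ₛ constₛ-1) (*ₛ-identityˡ 1ₛ))
  ^ₛ-constₛ-*ₛ a f (suc k) = begin
    (constₛ a *ₛ f) ^ₛ k *ₛ (constₛ a *ₛ f)
      ≈⟨ *ₛ-congʳ (constₛ a *ₛ f) (^ₛ-constₛ-*ₛ a f k) ⟩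
    (constₛ (_^ᴿ_ R F a k) *ₛ f ^ₛ k) *ₛ (constₛ a *ₛ f)
      ≈⟨ middle-swap (constₛ (_^ᴿ_ R F a k)) (f ^ₛ k) (constₛ a) f ⟩
    (constₛ (_^ᴿ_ R F a k) *ₛ constₛ a) *ₛ (f ^ₛ k *ₛ f)
      ≈⟨ *ₛ-congʳ (f ^ₛ k *ₛ f) (constₛ-* _ a) ⟩
    constₛ (_^ᴿ_ R F a (suc k)) *ₛ f ^ₛ suc k            ∎
    where
    open SetoidReasoning S.setoid
    open import Algebra.Properties.CommutativeSemigroup S.*-commutativeSemigroup
      renaming (interchange to middle-swap)

module Derivative {c ℓ} (R : CommutativeRing c ℓ) (F : IsCharZeroField R) where
  open CommutativeRing R hiding (zero)
  open FiniteSums R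
  open IntegerCoefficients R using (fromℕ-+)
  open PowerSeries R F
  open import Algebra.Properties.Ring ring using (-‿distribʳ-*)
  open import Algebra.Properties.CommutativeSemigroup *-commutativeSemigroup using (x∙yz≈y∙xz)
  private
    module S  = CommutativeRing seriesRing
    module SΣ = FiniteSums seriesRing
    module SZ = IntegerCoefficients seriesRing

  D : Series R F → Series R F
  D f n = fromℕ R (suc n) * f (suc n)

  fromℕ-suc-*-inv1+ : ∀ k → fromℕ R (suc k) * inv1+ R F k ≈ 1#
  fromℕ-suc-*-inv1+ k = proj₂ (IsCharZeroField.inverse F (fromℕ R (suc k)) (IsCharZeroField.charZero F k))

  inv1+-*-fromℕ-suc : ∀ k → inv1+ R F k * fromℕ R (suc k) ≈ 1#
  inv1+-*-fromℕ-suc k = trans (*-comm _ _) (fromℕ-suc-*-inv1+ k)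

  D≈0⇒coeff≈0 : ∀ f n → D f n ≈ 0# → f (suc n) ≈ 0#
  D≈0⇒coeff≈0 f n Dfₙ≈0 = begin
    f (suc n)                                   ≈⟨ *-identityˡ _ ⟨
    1# * f (suc n)                              ≈⟨ *-congʳ (inv1+-*-fromℕ-suc n) ⟨
    inv1+ R F n * fromℕ R (suc n) * f (suc n)   ≈⟨ *-assoc _ _ _ ⟩
    inv1+ R F n * D f n                         ≈⟨ *-congˡ Dfₙ≈0 ⟩
    inv1+ R F n * 0#                            ≈⟨ zeroʳ _ ⟩
    0#                                          ∎
    where open SetoidReasoning setoid

  D-cong : ∀ {f g} → f ≋ g → D f ≋ D g
  D-cong f≋g = coeffwise λ n → *-congˡ (coeff≈ f≋g (suc n))

  D-+ : ∀ f g → D (f +ₛ g) ≋ D f +ₛ D g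
  D-+ f g = coeffwise λ n → distribˡ _ _ _

  D-neg : ∀ f → D (-ₛ f) ≋ -ₛ D f
  D-neg f = coeffwise λ n → sym (-‿distribʳ-* _ _)

  D-constₛ : ∀ a → D (constₛ a) ≋ 0ₛ
  D-constₛ a = coeffwise λ n → zeroʳ _

  D-1 : D 1ₛ ≋ 0ₛ
  D-1 = coeffwise λ n → zeroʳ _

  D-constₛ-*ₛ : ∀ a f → D (constₛ a *ₛ f) ≋ constₛ a *ₛ D f
  D-constₛ-*ₛ a f = coeffwise λ n → begin
    fromℕ R (suc n) * (constₛ a *ₛ f) (suc n) ≈⟨ *-congˡ (constₛ-*ₛ a f (suc n)) ⟩
    fromℕ R (suc n) * (a * f (suc n))         ≈⟨ x∙yz≈y∙xz _ _ _ ⟩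
    a * (fromℕ R (suc n) * f (suc n))         ≈⟨ constₛ-*ₛ a (D f) n ⟨
    (constₛ a *ₛ D f) n                       ∎
    where open SetoidReasoning setoid

  D-*ₛ : ∀ f g → D (f *ₛ g) ≋ D f *ₛ g +ₛ f *ₛ D g
  D-*ₛ f g = coeffwise leibniz
    where
    open SetoidReasoning setoid
    left-weighted : ∀ n → Σ₀ (suc n) (λ k → fromℕ R k * (f k * g (suc n ∸ k))) ≈ (D f *ₛ g) n
    left-weighted n = begin
      Σ₀ (suc n) (λ k → fromℕ R k * (f k * g (suc n ∸ k)))
        ≈⟨ Σ₀-head n _ ⟩
      0# * (f 0 * g (suc n)) + Σ₀ n (λ k → fromℕ R (suc k) * (f (suc k) * g (n ∸ k)))
        ≈⟨ +-cong (zeroˡ _) (Σ₀-cong n (λ k → sym (*-assoc _ _ _))) ⟩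
      0# + Σ₀ n (λ k → D f k * g (n ∸ k))
        ≈⟨ +-identityˡ _ ⟩
      Σ₀ n (λ k → D f k * g (n ∸ k))
        ≈⟨ *ₛ-coeff (D f) g n ⟨
      (D f *ₛ g) n ∎
    right-weighted : ∀ n → Σ₀ (suc n) (λ k → fromℕ R (suc n ∸ k) * (f k * g (suc n ∸ k))) ≈ (f *ₛ D g) n
    right-weighted n = begin
      Σ₀ n (λ k → fromℕ R (suc n ∸ k) * (f k * g (suc n ∸ k)))
        + fromℕ R (suc n ∸ suc n) * (f (suc n) * g (suc n ∸ suc n))
        ≈⟨ +-cong (Σ₀-cong-≤ n (λ k k≤n → trans
                    (reflexive (≡.cong (λ m → fromℕ R m * (f k * g m)) (ℕₚ.+-∸-assoc 1 k≤n)))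
                                                 (x∙yz≈y∙xz _ _ _)))
                  (trans (*-congʳ (reflexive (≡.cong (fromℕ R) (ℕₚ.n∸n≡0 n)))) (zeroˡ _)) ⟩
      Σ₀ n (λ k → f k * D g (n ∸ k)) + 0#
        ≈⟨ +-identityʳ _ ⟩
      Σ₀ n (λ k → f k * D g (n ∸ k))
        ≈⟨ *ₛ-coeff f (D g) n ⟨
      (f *ₛ D g) n ∎
    leibniz : ∀ n → D (f *ₛ g) n ≈ (D f *ₛ g +ₛ f *ₛ D g) n
    leibniz n = begin
      fromℕ R (suc n) * (f *ₛ g) (suc n)
        ≈⟨ *-congˡ (*ₛ-coeff f g (suc n)) ⟩
      fromℕ R (suc n) * Σ₀ (suc n) (λ k → f k * g (suc n ∸ k))
        ≈⟨ *-distribˡ-Σ₀ (suc n) _ _ ⟩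
      Σ₀ (suc n) (λ k → fromℕ R (suc n) * (f k * g (suc n ∸ k)))
        ≈⟨ Σ₀-cong-≤ (suc n) split-weight ⟩
      Σ₀ (suc n) (λ k → fromℕ R k * (f k * g (suc n ∸ k)) + fromℕ R (suc n ∸ k) * (f k * g (suc n ∸ k)))
                                                                      ≈⟨ Σ₀-+ (suc n) _ _ ⟩
      Σ₀ (suc n) (λ k → fromℕ R k * (f k * g (suc n ∸ k)))
        + Σ₀ (suc n) (λ k → fromℕ R (suc n ∸ k) * (f k * g (suc n ∸ k)))
        ≈⟨ +-cong (left-weighted n) (right-weighted n) ⟩
      (D f *ₛ g) n + (f *ₛ D g) n                                     ∎
      where
      split-weight : ∀ k → k ≤ suc n →
                     fromℕ R (suc n) * (f k * g (suc n ∸ k))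
                       ≈ fromℕ R k * (f k * g (suc n ∸ k)) + fromℕ R (suc n ∸ k) * (f k * g (suc n ∸ k))
      split-weight k k≤ = trans
        (*-congʳ (trans (reflexive (≡.cong (fromℕ R) (≡.sym (ℕₚ.m+[n∸m]≡n k≤)))) (fromℕ-+ k (suc n ∸ k))))
        (distribʳ _ _ _)

  D-^ₛ : ∀ f k → D (f ^ₛ suc k) ≋ constₛ (fromℕ R (suc k)) *ₛ (f ^ₛ k *ₛ D f)
  D-^ₛ f zero    = begin
    D (1ₛ *ₛ f)                        ≈⟨ D-cong (*ₛ-identityˡ f) ⟩
    D f                                ≈⟨ *ₛ-identityˡ (D f) ⟨
    1ₛ *ₛ D f                          ≈⟨ *ₛ-identityˡ (1ₛ *ₛ D f) ⟨
    1ₛ *ₛ (1ₛ *ₛ D f)                  ≈⟨ *ₛ-congʳ (1ₛ *ₛ D f) (S.trans (constₛ-cong (+-identityʳ 1#)) constₛ-1) ⟨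
    constₛ (fromℕ R 1) *ₛ (1ₛ *ₛ D f)  ∎
    where open SetoidReasoning S.setoid
  D-^ₛ f (suc k) = begin
    D (f ^ₛ suc k *ₛ f)
      ≈⟨ D-*ₛ (f ^ₛ suc k) f ⟩
    D (f ^ₛ suc k) *ₛ f +ₛ f ^ₛ suc k *ₛ D f
      ≈⟨ S.+-congʳ (*ₛ-congʳ f (D-^ₛ f k)) ⟩
    constₛ (fromℕ R (suc k)) *ₛ (f ^ₛ k *ₛ D f) *ₛ f +ₛ f ^ₛ suc k *ₛ D f
      ≈⟨ collect (constₛ (fromℕ R (suc k))) (f ^ₛ k) (D f) f ⟩
    (1ₛ +ₛ constₛ (fromℕ R (suc k))) *ₛ (f ^ₛ suc k *ₛ D f)
      ≈⟨ *ₛ-congʳ (f ^ₛ suc k *ₛ D f)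
         (S.trans (S.+-congʳ (S.sym constₛ-1)) (constₛ-+ 1# _)) ⟩
    constₛ (fromℕ R (suc (suc k))) *ₛ (f ^ₛ suc k *ₛ D f)              ∎
    where
    open SetoidReasoning S.setoid
    collect : ∀ c p d f → c *ₛ (p *ₛ d) *ₛ f +ₛ (p *ₛ f) *ₛ d ≋ (1ₛ +ₛ c) *ₛ ((p *ₛ f) *ₛ d)
    collect = solve 4 (λ c p d f → c :* (p :* d) :* f :+ (p :* f) :* d := (con (+ 1) :+ c) :* ((p :* f) :* d)) S.refl
      where open SZ

  D-Σ₀ : ∀ N G → D (SΣ.Σ₀ N G) ≋ SΣ.Σ₀ N (λ k → D (G k))
  D-Σ₀ zero    G = S.refl
  D-Σ₀ (suc N) G = S.trans (D-+ (SΣ.Σ₀ N G) (G (suc N))) (S.+-congʳ (D-Σ₀ N G))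

  D-Σ₁ : ∀ N G → D (SΣ.Σ₁ N G) ≋ SΣ.Σ₁ N (λ k → D (G k))
  D-Σ₁ zero    G = D-constₛ 0#
  D-Σ₁ (suc N) G = S.trans (D-+ (SΣ.Σ₁ N G) (G (suc N))) (S.+-congʳ (D-Σ₁ N G))

  D-monomial : ∀ a u k → D (constₛ a *ₛ u ^ₛ suc k) ≋ constₛ (a * fromℕ R (suc k)) *ₛ u ^ₛ k *ₛ D u
  D-monomial a u k = begin
    D (constₛ a *ₛ u ^ₛ suc k)
      ≈⟨ D-constₛ-*ₛ a (u ^ₛ suc k) ⟩
    constₛ a *ₛ D (u ^ₛ suc k)
      ≈⟨ *ₛ-congˡ (constₛ a) (D-^ₛ u k) ⟩
    constₛ a *ₛ (constₛ (fromℕ R (suc k)) *ₛ (u ^ₛ k *ₛ D u))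
      ≈⟨ *ₛ-assoc (constₛ a) _ (u ^ₛ k *ₛ D u) ⟨
    constₛ a *ₛ constₛ (fromℕ R (suc k)) *ₛ (u ^ₛ k *ₛ D u)
      ≈⟨ *ₛ-congʳ (u ^ₛ k *ₛ D u) (constₛ-* a _) ⟩
    constₛ (a * fromℕ R (suc k)) *ₛ (u ^ₛ k *ₛ D u)
      ≈⟨ *ₛ-assoc (constₛ (a * fromℕ R (suc k))) (u ^ₛ k) (D u) ⟨
    constₛ (a * fromℕ R (suc k)) *ₛ u ^ₛ k *ₛ D u                     ∎
    where open SetoidReasoning S.setoid

  D-polynomial : ∀ (a : ℕ → Carrier) u N → D (SΣ.Σ₀ (suc N) (λ k → constₛ (a k) *ₛ u ^ₛ k))
                           ≋ SΣ.Σ₀ N (λ k → constₛ (a (suc k) * fromℕ R (suc k)) *ₛ u ^ₛ k) *ₛ D u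
  D-polynomial a u N = begin
    D (SΣ.Σ₀ (suc N) (λ k → constₛ (a k) *ₛ u ^ₛ k))
      ≈⟨ D-Σ₀ (suc N) _ ⟩
    SΣ.Σ₀ (suc N) (λ k → D (constₛ (a k) *ₛ u ^ₛ k))
      ≈⟨ SΣ.Σ₀-head N _ ⟩
    D (constₛ (a 0) *ₛ 1ₛ) +ₛ SΣ.Σ₀ N (λ k → D (constₛ (a (suc k)) *ₛ u ^ₛ suc k))
      ≈⟨ S.+-cong (S.trans (D-constₛ-*ₛ (a 0) 1ₛ) (S.trans (*ₛ-congˡ (constₛ (a 0)) D-1) (S.zeroʳ _)))
                  (SΣ.Σ₀-cong N (λ k → D-monomial (a (suc k)) u k)) ⟩
    0ₛ +ₛ SΣ.Σ₀ N (λ k → constₛ (a (suc k) * fromℕ R (suc k)) *ₛ u ^ₛ k *ₛ D u)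
      ≈⟨ S.+-identityˡ _ ⟩
    SΣ.Σ₀ N (λ k → constₛ (a (suc k) * fromℕ R (suc k)) *ₛ u ^ₛ k *ₛ D u)
      ≈⟨ SΣ.*-distribʳ-Σ₀ N (D u) _ ⟨
    SΣ.Σ₀ N (λ k → constₛ (a (suc k) * fromℕ R (suc k)) *ₛ u ^ₛ k) *ₛ D u ∎
    where open SetoidReasoning S.setoid

module Vanishing {c ℓ} (R : CommutativeRing c ℓ) (F : IsCharZeroField R) where
  open CommutativeRing R hiding (zero)
  open FiniteSums R
  open PowerSeries R F
  open Derivative R F
  open import Algebra.Properties.Ring ring using (-0#≈0#)
  private
    module S = CommutativeRing seriesRing

  infix 4 _vanishesBelow_

  _vanishesBelow_ : Series R F → ℕ → Set ℓ
  f vanishesBelow a = ∀ i → i < a → f i ≈ 0#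

  vanishesBelow-*ₛ : ∀ {f g a b} → f vanishesBelow a → g vanishesBelow b → f *ₛ g vanishesBelow a ℕ.+ b
  vanishesBelow-*ₛ {f} {g} {a} {b} f≈0 g≈0 i i<a+b = trans (*ₛ-coeff f g i) (Σ₀-zero i term≈0)
    where
    term≈0 : ∀ k → k ≤ i → f k * g (i ∸ k) ≈ 0#
    term≈0 k k≤i with k ℕ.<? a
    ... | yes k<a = trans (*-congʳ (f≈0 k k<a)) (zeroˡ _)
    ... | no  k≮a = trans (*-congˡ (g≈0 (i ∸ k) i∸k<b)) (zeroʳ _)
      where
      i∸k<b : i ∸ k < b
      i∸k<b = ℕₚ.+-cancelˡ-< k (i ∸ k) b (ℕₚ.<-≤-trans (ℕₚ.≤-<-trans (ℕₚ.≤-reflexive (ℕₚ.m+[n∸m]≡n k≤i)) i<a+b)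
                                                         (ℕₚ.+-monoˡ-≤ b (ℕₚ.≮⇒≥ k≮a)))

  vanishesBelow-+ₛ : ∀ {f g a} → f vanishesBelow a → g vanishesBelow a → f +ₛ g vanishesBelow a
  vanishesBelow-+ₛ f≈0 g≈0 i i<a = trans (+-cong (f≈0 i i<a) (g≈0 i i<a)) (+-identityʳ 0#)

  vanishesBelow--ₛ : ∀ {f a} → f vanishesBelow a → -ₛ f vanishesBelow a
  vanishesBelow--ₛ f≈0 i i<a = trans (-‿cong (f≈0 i i<a)) -0#≈0#

  vanishesBelow-resp-≋ : ∀ {f g a} → f ≋ g → f vanishesBelow a → g vanishesBelow a
  vanishesBelow-resp-≋ f≋g f≈0 i i<a = trans (sym (coeff≈ f≋g i)) (f≈0 i i<a)

  vanishesBelow-mono : ∀ {f a b} → b ≤ a → f vanishesBelow a → f vanishesBelow b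
  vanishesBelow-mono b≤a f≈0 i i<b = f≈0 i (ℕₚ.<-≤-trans i<b b≤a)

  vanishesBelow-suc : ∀ {f a} → f vanishesBelow a → f a ≈ 0# → f vanishesBelow suc a
  vanishesBelow-suc {a = a} f≈0 fₐ≈0 i i<1+a with ℕₚ.m≤n⇒m<n∨m≡n (ℕₚ.≤-pred i<1+a)
  ... | inj₁ i<a    = f≈0 i i<a
  ... | inj₂ ≡.refl = fₐ≈0

  vanishesBelow-D : ∀ {f a} → f vanishesBelow suc a → D f vanishesBelow a
  vanishesBelow-D f≈0 i i<a = trans (*-congˡ (f≈0 (suc i) (s≤s i<a))) (zeroʳ _)

  vanishesBelow-*ₛʳ : ∀ {f a} g → f vanishesBelow a → f *ₛ g vanishesBelow a
  vanishesBelow-*ₛʳ {f} {a} g f≈0 =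
    vanishesBelow-mono (ℕₚ.≤-reflexive (≡.sym (ℕₚ.+-identityʳ a))) (vanishesBelow-*ₛ {g = g} {b = 0} f≈0 (λ i ()))

  vanishesBelow-*ₛˡ : ∀ {f a} g → f vanishesBelow a → g *ₛ f vanishesBelow a
  vanishesBelow-*ₛˡ {f} g f≈0 = vanishesBelow-resp-≋ (*ₛ-comm f g) (vanishesBelow-*ₛʳ g f≈0)

  vanishesBelow-1 : ∀ {f} → f 0 ≈ 0# → f vanishesBelow 1
  vanishesBelow-1 f₀≈0 zero    _         = f₀≈0
  vanishesBelow-1 f₀≈0 (suc i) (s≤s ())

  vanishesBelow-^ₛ : ∀ {f} → f 0 ≈ 0# → ∀ k → f ^ₛ k vanishesBelow k
  vanishesBelow-^ₛ f₀≈0 zero    i ()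
  vanishesBelow-^ₛ {f} f₀≈0 (suc k) =
    vanishesBelow-mono (ℕₚ.≤-reflexive (ℕₚ.+-comm 1 k))
      (vanishesBelow-*ₛ (vanishesBelow-^ₛ f₀≈0 k) (vanishesBelow-1 {f} f₀≈0))

  next-coeff-vanishes : ∀ u Y n → u 0 ≈ 0# → Y vanishesBelow suc n →
                        ((1ₛ +ₛ u) *ₛ D Y) n ≈ 0# → Y (suc n) ≈ 0#
  next-coeff-vanishes u Y n u₀≈0 Y≈0 qDYₙ≈0 = D≈0⇒coeff≈0 Y n (begin
    D Y n
      ≈⟨ +-identityʳ _ ⟨
    D Y n + 0#
      ≈⟨ +-cong (coeff≈ (*ₛ-identityˡ (D Y)) n)
                (vanishesBelow-*ₛ (vanishesBelow-1 {u} u₀≈0) (vanishesBelow-D Y≈0) n ℕₚ.≤-refl) ⟨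
    (1ₛ *ₛ D Y) n + (u *ₛ D Y) n
      ≈⟨ coeff≈ (*ₛ-distribʳ (D Y) 1ₛ u) n ⟨
    ((1ₛ +ₛ u) *ₛ D Y) n
      ≈⟨ qDYₙ≈0 ⟩
    0#                                  ∎)
    where open SetoidReasoning setoid

  ^ₛ-difference-vanishes : ∀ X Y m → X 0 ≈ 0# → Y 0 ≈ 0# → X +ₛ -ₛ Y vanishesBelow suc m →
                           ∀ k → X ^ₛ suc k +ₛ -ₛ Y ^ₛ suc k vanishesBelow suc (m ℕ.+ k)
  ^ₛ-difference-vanishes X Y m X₀≈0 Y₀≈0 X-Y≈0 zero =
    vanishesBelow-mono (ℕₚ.≤-reflexive (≡.cong suc (ℕₚ.+-identityʳ m)))
      (vanishesBelow-resp-≋ (S.sym (S.+-cong (*ₛ-identityˡ X) (S.-‿cong (*ₛ-identityˡ Y)))) X-Y≈0)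
  ^ₛ-difference-vanishes X Y m X₀≈0 Y₀≈0 X-Y≈0 (suc k) =
    vanishesBelow-resp-≋ (S.sym (split (X ^ₛ suc k) (Y ^ₛ suc k) X Y))
      (vanishesBelow-+ₛ
        (vanishesBelow-mono (ℕₚ.≤-reflexive left-degree)
          (vanishesBelow-*ₛ (^ₛ-difference-vanishes X Y m X₀≈0 Y₀≈0 X-Y≈0 k) (vanishesBelow-1 {X} X₀≈0)))
        (vanishesBelow-mono (ℕₚ.≤-reflexive right-degree)
          (vanishesBelow-*ₛ {Y ^ₛ suc k} (vanishesBelow-^ₛ Y₀≈0 (suc k)) X-Y≈0)))
    where
    split : ∀ x′ y′ x y → x′ *ₛ x +ₛ -ₛ (y′ *ₛ y) ≋ (x′ +ₛ -ₛ y′) *ₛ x +ₛ y′ *ₛ (x +ₛ -ₛ y)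
    split = solve 4 (λ x′ y′ x y → x′ :* x :- y′ :* y := (x′ :- y′) :* x :+ y′ :* (x :- y)) S.refl
      where open IntegerCoefficients seriesRing
    left-degree : suc (m ℕ.+ suc k) ≡ suc (m ℕ.+ k) ℕ.+ 1
    left-degree = ≡.trans (≡.cong suc (ℕₚ.+-suc m k)) (ℕₚ.+-comm 1 (suc (m ℕ.+ k)))
    right-degree : suc (m ℕ.+ suc k) ≡ suc k ℕ.+ suc m
    right-degree = ≡.cong suc (≡.trans (ℕₚ.+-comm m (suc k)) (≡.sym (ℕₚ.+-suc k m)))

module Exponential {c ℓ} (R : CommutativeRing c ℓ) (F : IsCharZeroField R) where
  open CommutativeRing R hiding (zero)
  open FiniteSums R
  open PowerSeries R F
  open Derivative R F
  open Vanishing R F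
  private
    module S  = CommutativeRing seriesRing
    module SΣ = FiniteSums seriesRing

  invFact-suc-*-fromℕ : ∀ k → invFact R F (suc k) * fromℕ R (suc k) ≈ invFact R F k
  invFact-suc-*-fromℕ k = trans (*-assoc _ _ _) (trans (*-congˡ (inv1+-*-fromℕ-suc k)) (*-identityʳ _))

  expTerm : Series R F → ℕ → Series R F
  expTerm v k = constₛ (invFact R F k) *ₛ v ^ₛ k

  expTrunc : ℕ → Series R F → Series R F
  expTrunc N v = SΣ.Σ₀ N (expTerm v)

  expS≈expTrunc : ∀ v → v 0 ≈ 0# → ∀ {n N} → n ≤ N → expS R F v n ≈ expTrunc N v n
  expS≈expTrunc v v₀≈0 {n} {N} n≤N = begin
    expS R F v n                                        ≡⟨ sumTo≡Σ₀ n _ ⟩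
    Σ₀ n (λ k → invFact R F k * (v ^ₛ k) n)             ≈⟨ Σ₀-extend n N n≤N high-terms≈0 ⟨
    Σ₀ N (λ k → invFact R F k * (v ^ₛ k) n)             ≈⟨ Σ₀-cong N (λ k → constₛ-*ₛ (invFact R F k) (v ^ₛ k) n) ⟨
    Σ₀ N (λ k → (constₛ (invFact R F k) *ₛ v ^ₛ k) n)   ≈⟨ Σ₀-coeff N _ n ⟨
    expTrunc N v n                                      ∎
    where
    open SetoidReasoning setoid
    high-terms≈0 : ∀ k → n < k → k ≤ N → invFact R F k * (v ^ₛ k) n ≈ 0#
    high-terms≈0 k n<k _ = trans (*-congˡ (vanishesBelow-^ₛ v₀≈0 k n n<k)) (zeroʳ _)

  D-expTrunc : ∀ v N → D (expTrunc (suc N) v) ≋ expTrunc N v *ₛ D v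
  D-expTrunc v N = S.trans (D-polynomial (invFact R F) v N)
    (*ₛ-congʳ (D v) (SΣ.Σ₀-cong N (λ k → *ₛ-congʳ (v ^ₛ k) (constₛ-cong (invFact-suc-*-fromℕ k)))))

  D-expS : ∀ v → v 0 ≈ 0# → D (expS R F v) ≋ expS R F v *ₛ D v
  D-expS v v₀≈0 = coeffwise λ n → begin
    fromℕ R (suc n) * expS R F v (suc n)
      ≈⟨ *-congˡ (expS≈expTrunc v v₀≈0 {suc n} ℕₚ.≤-refl) ⟩
    D (expTrunc (suc n) v) n
      ≈⟨ coeff≈ (D-expTrunc v n) n ⟩
    (expTrunc n v *ₛ D v) n
      ≈⟨ *ₛ-cong-≤ {g = D v} n (λ i i≤n → sym (expS≈expTrunc v v₀≈0 i≤n)) (λ _ _ → refl) ⟩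
    (expS R F v *ₛ D v) n                    ∎
    where open SetoidReasoning setoid

module Logarithm {c ℓ} (R : CommutativeRing c ℓ) (F : IsCharZeroField R) where
  open CommutativeRing R hiding (zero)
  open FiniteSums R
  open PowerSeries R F
  open Derivative R F
  open Vanishing R F
  open import Algebra.Properties.Ring ring using (-1*x≈-x; -0#≈0#)
  private
    module S  = CommutativeRing seriesRing
    module SΣ = FiniteSums seriesRing
    module SZ = IntegerCoefficients seriesRing

  sgn : ℕ → Carrier
  sgn k = _^ᴿ_ R F (- 1#) (suc k)

  sgn-suc : ∀ k → constₛ (sgn (suc k)) ≋ -ₛ constₛ (sgn k)
  sgn-suc k = S.trans (constₛ-cong (trans (*-comm _ _) (-1*x≈-x _))) (S.sym (constₛ-neg (sgn k)))

  logTrunc : ℕ → Series R F → Series R F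
  logTrunc N w = SΣ.Σ₁ N (λ k → constₛ (sgn k * inv1+ R F (k ∸ 1)) *ₛ w ^ₛ k)

  geomTrunc : ℕ → Series R F → Series R F
  geomTrunc N w = SΣ.Σ₁ N (λ k → constₛ (sgn k) *ₛ w ^ₛ (k ∸ 1))

  logS≈logTrunc : ∀ f → (_⊖_ R F f 1ₛ) 0 ≈ 0# → ∀ {n N} → n ≤ N → logS R F f n ≈ logTrunc N (_⊖_ R F f 1ₛ) n
  logS≈logTrunc f w₀≈0 {n} {N} n≤N = begin
    logS R F f n                                     ≡⟨ sum1To≡Σ₁ n _ ⟩
    Σ₁ n (λ k → sgn k * inv1+ R F (k ∸ 1) * (w ^ₛ k) n) ≈⟨ Σ₁-extend n N n≤N high-terms≈0 ⟨
    Σ₁ N (λ k → sgn k * inv1+ R F (k ∸ 1) * (w ^ₛ k) n) ≈⟨ Σ₁-cong-< N (λ k _ → constₛ-*ₛ _ (w ^ₛ suc k) n) ⟨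
    Σ₁ N (λ k → (constₛ (sgn k * inv1+ R F (k ∸ 1)) *ₛ w ^ₛ k) n) ≈⟨ Σ₁-coeff N _ n ⟨
    logTrunc N w n                                   ∎
    where
    open SetoidReasoning setoid
    w : Series R F
    w = _⊖_ R F f 1ₛ
    high-terms≈0 : ∀ k → n < k → k ≤ N → sgn k * inv1+ R F (k ∸ 1) * (w ^ₛ k) n ≈ 0#
    high-terms≈0 k n<k _ = trans (*-congˡ (vanishesBelow-^ₛ w₀≈0 k n n<k)) (zeroʳ _)

  D-logTrunc : ∀ N w → D (logTrunc N w) ≋ geomTrunc N w *ₛ D w
  D-logTrunc N w = S.trans (D-Σ₁ N _) (S.trans (SΣ.Σ₁-cong-< N term) (S.sym (SΣ.*-distribʳ-Σ₁ N (D w) _)))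
    where
    term : ∀ j → j < N → D (constₛ (sgn (suc j) * inv1+ R F j) *ₛ w ^ₛ suc j) ≋ constₛ (sgn (suc j)) *ₛ w ^ₛ j *ₛ D w
    term j _ = S.trans (D-monomial (sgn (suc j) * inv1+ R F j) w j)
      (*ₛ-congʳ (D w) (*ₛ-congʳ (w ^ₛ j) (constₛ-cong
        (trans (*-assoc _ _ _) (trans (*-congˡ (inv1+-*-fromℕ-suc j)) (*-identityʳ _))))))

  geomTrunc-telescopes : ∀ N w → (1ₛ +ₛ w) *ₛ geomTrunc N w ≋ 1ₛ +ₛ constₛ (sgn N) *ₛ w ^ₛ N
  geomTrunc-telescopes zero    w = coeffwise λ n → trans (coeff≈ (S.zeroʳ (1ₛ +ₛ w)) n) (sym (base n))
    where
    base : ∀ n → 1ₛ n + (constₛ (sgn 0) *ₛ 1ₛ) n ≈ 0#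
    base zero    = trans (+-congˡ (*-congʳ (*-identityˡ _))) (trans (+-congˡ (*-identityʳ _)) (-‿inverseʳ 1#))
    base (suc n) = trans (+-identityˡ _) (trans (constₛ-*ₛ (sgn 0) 1ₛ (suc n)) (zeroʳ _))
  geomTrunc-telescopes (suc N) w = begin
    (1ₛ +ₛ w) *ₛ (geomTrunc N w +ₛ constₛ s′ *ₛ w ^ₛ N)
      ≈⟨ S.distribˡ (1ₛ +ₛ w) (geomTrunc N w) (constₛ s′ *ₛ w ^ₛ N) ⟩
    (1ₛ +ₛ w) *ₛ geomTrunc N w +ₛ (1ₛ +ₛ w) *ₛ (constₛ s′ *ₛ w ^ₛ N)
      ≈⟨ S.+-cong (geomTrunc-telescopes N w) (*ₛ-congˡ (1ₛ +ₛ w) (*ₛ-congʳ (w ^ₛ N) (sgn-suc N))) ⟩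
    (1ₛ +ₛ constₛ s *ₛ w ^ₛ N) +ₛ (1ₛ +ₛ w) *ₛ (-ₛ constₛ s *ₛ w ^ₛ N)
      ≈⟨ cancel (constₛ s) (w ^ₛ N) w ⟩
    1ₛ +ₛ -ₛ constₛ s *ₛ (w ^ₛ N *ₛ w)
      ≈⟨ S.+-congˡ (*ₛ-congʳ (w ^ₛ suc N) (sgn-suc N)) ⟨
    1ₛ +ₛ constₛ s′ *ₛ w ^ₛ suc N ∎
    where
    open SetoidReasoning S.setoid
    s s′ : Carrier
    s  = sgn N
    s′ = sgn (suc N)
    cancel : ∀ a p w → (1ₛ +ₛ a *ₛ p) +ₛ (1ₛ +ₛ w) *ₛ (-ₛ a *ₛ p) ≋ 1ₛ +ₛ -ₛ a *ₛ (p *ₛ w)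
    cancel = solve 3 (λ a p w → (con (+ 1) :+ a :* p) :+ (con (+ 1) :+ w) :* (:- a :* p)
                                  := con (+ 1) :+ :- a :* (p :* w)) S.refl
      where open SZ

  D-logS : ∀ f → f 0 ≈ 1# → f *ₛ D (logS R F f) ≋ D f
  D-logS f f₀≈1 = coeffwise λ n → begin
    (f *ₛ D (logS R F f)) n
      ≈⟨ *ₛ-cong-≤ {g′ = D (logTrunc (suc n) w)} n (λ _ _ → refl)
                   (λ i i≤n → *-congˡ (logS≈logTrunc f w₀≈0 {suc i} {suc n} (s≤s i≤n))) ⟩
    (f *ₛ D (logTrunc (suc n) w)) n
      ≈⟨ coeff≈ (*ₛ-cong f≋1+w (D-logTrunc (suc n) w)) n ⟩
    ((1ₛ +ₛ w) *ₛ (geomTrunc (suc n) w *ₛ D w)) n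
      ≈⟨ coeff≈ (S.trans (S.sym (*ₛ-assoc (1ₛ +ₛ w) (geomTrunc (suc n) w) (D w)))
                         (*ₛ-congʳ (D w) (geomTrunc-telescopes (suc n) w))) n ⟩
    ((1ₛ +ₛ constₛ (sgn (suc n)) *ₛ w ^ₛ suc n) *ₛ D w) n
      ≈⟨ coeff≈ (*ₛ-distribʳ (D w) 1ₛ _) n ⟩
    (1ₛ *ₛ D w) n + (constₛ (sgn (suc n)) *ₛ w ^ₛ suc n *ₛ D w) n
      ≈⟨ +-cong (coeff≈ (*ₛ-identityˡ (D w)) n)
                (vanishesBelow-*ₛʳ (D w) (vanishesBelow-*ₛˡ (constₛ _) (vanishesBelow-^ₛ w₀≈0 (suc n))) n ℕₚ.≤-refl) ⟩
    D w n + 0#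
      ≈⟨ +-identityʳ _ ⟩
    fromℕ R (suc n) * (f (suc n) + - 0#)
      ≈⟨ *-congˡ (trans (+-congˡ -0#≈0#) (+-identityʳ _)) ⟩
    D f n ∎
    where
    open SetoidReasoning setoid
    w : Series R F
    w = _⊖_ R F f 1ₛ
    w₀≈0 : w 0 ≈ 0#
    w₀≈0 = trans (+-congʳ f₀≈1) (-‿inverseʳ 1#)
    f≋1+w : f ≋ 1ₛ +ₛ w
    f≋1+w = coeffwise λ m → solve 2 (λ x y → x := y :+ (x :- y)) refl (f m) (1ₛ m)
      where open IntegerCoefficients R

module Reciprocal {c ℓ} (R : CommutativeRing c ℓ) (F : IsCharZeroField R) where
  open CommutativeRing R hiding (zero)
  open FiniteSums R
  open PowerSeries R F
  open import Data.Bool using (false)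
  open import Data.Bool.Properties using (T-≡)
  open import Function.Bundles using (Equivalence)

  private
    1+n≰ᵇn : ∀ n → (suc n ℕ.≤ᵇ n) ≡ false
    1+n≰ᵇn zero    = ≡.refl
    1+n≰ᵇn (suc n) = 1+n≰ᵇn n

    -- recipS is a diagonal of a helper that is private to Defs; the helper is recovered from the
    -- unfolding of recipS at a successor, where Agda infers it for the underscore.
    recipS-unfold : ∀ (a : Series R F) (c′ : Carrier) n →
                    recipS R F a c′ (suc n) ≡ - (c′ * sum1To R F (suc n) (λ k → a k * _))
    recipS-unfold a c′ n rewrite 1+n≰ᵇn n = ≡.refl

    summand : ∀ (a : Series R F) (c′ : Carrier) n {x} {h : ℕ → Carrier} →
              x ≡ - (c′ * sum1To R F (suc n) (λ k → a k * h k)) → ℕ → Carrier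
    summand _ _ _ {h = h} _ = h

    previous : Series R F → Carrier → ℕ → ℕ → Carrier
    previous a c′ n = summand a c′ n (recipS-unfold a c′ n)

    previous-step : ∀ a c′ n j → j ≤ n → previous a c′ (suc n) (suc (suc n) ∸ j) ≡ previous a c′ n (suc n ∸ j)
    previous-step a c′ n j j≤n
      rewrite ℕₚ.m∸[m∸n]≡n {suc (suc n)} {j} (ℕₚ.m≤n⇒m≤1+n (ℕₚ.m≤n⇒m≤1+n j≤n))
            | ℕₚ.m∸[m∸n]≡n {suc n} {j} (ℕₚ.m≤n⇒m≤1+n j≤n)
            | Equivalence.to T-≡ (ℕₚ.≤⇒≤ᵇ j≤n) = ≡.refl

    previous-last : ∀ a c′ n → previous a c′ n (suc n ∸ n) ≡ recipS R F a c′ n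
    previous-last a c′ n rewrite ℕₚ.m∸[m∸n]≡n {suc n} {n} (ℕₚ.n≤1+n n) = ≡.refl

    previous≡recipS : ∀ a c′ n j → j ≤ n → previous a c′ n (suc n ∸ j) ≡ recipS R F a c′ j
    previous≡recipS a c′ n j j≤n with ℕₚ.m≤n⇒m<n∨m≡n j≤n
    ... | inj₂ ≡.refl = previous-last a c′ j
    previous≡recipS a c′ (suc n) j _ | inj₁ (s≤s j≤n) =
      ≡.trans (previous-step a c′ n j j≤n) (previous≡recipS a c′ n j j≤n)

  recipS-suc : ∀ a c′ n → recipS R F a c′ (suc n) ≈ - (c′ * Σ₁ (suc n) (λ k → a k * recipS R F a c′ (suc n ∸ k)))
  recipS-suc a c′ n = begin
    recipS R F a c′ (suc n)
      ≡⟨ recipS-unfold a c′ n ⟩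
    - (c′ * sum1To R F (suc n) (λ k → a k * previous a c′ n k))
      ≡⟨ ≡.cong (λ s → - (c′ * s)) (sum1To≡Σ₁ (suc n) _) ⟩
    - (c′ * Σ₁ (suc n) (λ k → a k * previous a c′ n k))
      ≈⟨ -‿cong (*-congˡ (Σ₁-cong-< (suc n) λ k k<1+n →
           *-congˡ (reflexive (previous≡recipS′ k k<1+n)))) ⟩
    - (c′ * Σ₁ (suc n) (λ k → a k * recipS R F a c′ (suc n ∸ k)))    ∎
    where
    open SetoidReasoning setoid
    previous≡recipS′ : ∀ k → k < suc n → previous a c′ n (suc k) ≡ recipS R F a c′ (suc n ∸ suc k)
    previous≡recipS′ k k<1+n = ≡.trans (≡.cong (previous a c′ n) (≡.sym (ℕₚ.m∸[m∸n]≡n k<1+n)))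
                                       (previous≡recipS a c′ n (n ∸ k) (ℕₚ.m∸n≤m n k))

  *ₛ-recipS : ∀ a c′ → a 0 * c′ ≈ 1# → a *ₛ recipS R F a c′ ≋ 1ₛ
  *ₛ-recipS a c′ a₀c′≈1 = coeffwise λ { zero → a₀c′≈1 ; (suc n) → higher n }
    where
    open SetoidReasoning setoid
    g : Series R F
    g = recipS R F a c′
    higher : ∀ n → (a *ₛ g) (suc n) ≈ 0#
    higher n = begin
      (a *ₛ g) (suc n)                         ≈⟨ *ₛ-coeff a g (suc n) ⟩
      Σ₀ (suc n) (λ k → a k * g (suc n ∸ k))   ≈⟨ Σ₀≈head+Σ₁ (suc n) _ ⟩
      a 0 * g (suc n) + S                      ≈⟨ +-congʳ (*-congˡ (recipS-suc a c′ n)) ⟩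
      a 0 * - (c′ * S) + S                     ≈⟨ +-congʳ (lemma (a 0) c′ S) ⟩
      - ((a 0 * c′) * S) + S                   ≈⟨ +-congʳ (-‿cong (*-congʳ a₀c′≈1)) ⟩
      - (1# * S) + S                           ≈⟨ +-congʳ (-‿cong (*-identityˡ S)) ⟩
      - S + S                                  ≈⟨ -‿inverseˡ S ⟩
      0#                                       ∎
      where
      S : Carrier
      S = Σ₁ (suc n) (λ k → a k * g (suc n ∸ k))
      lemma : ∀ x y z → x * - (y * z) ≈ - ((x * y) * z)
      lemma = solve 3 (λ x y z → x :* :- (y :* z) := :- ((x :* y) :* z)) refl
        where open IntegerCoefficients R

module Binomial {c ℓ} (R : CommutativeRing c ℓ) (F : IsCharZeroField R) where
  open CommutativeRing R hiding (zero)
  open PowerSeries R F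
  open Derivative R F
  open Exponential R F
  private
    module S  = CommutativeRing seriesRing
    module SΣ = FiniteSums seriesRing

  constₛ-inv1+-cancel : ∀ k f → constₛ (inv1+ R F k) *ₛ (constₛ (fromℕ R (suc k)) *ₛ f) ≋ f
  constₛ-inv1+-cancel k f = begin
    constₛ (inv1+ R F k) *ₛ (constₛ (fromℕ R (suc k)) *ₛ f)
      ≈⟨ *ₛ-assoc (constₛ _) (constₛ _) f ⟨
    constₛ (inv1+ R F k) *ₛ constₛ (fromℕ R (suc k)) *ₛ f
      ≈⟨ *ₛ-congʳ f (S.trans (constₛ-* _ _) (constₛ-cong (inv1+-*-fromℕ-suc k))) ⟩
    constₛ 1# *ₛ f
      ≈⟨ *ₛ-congʳ f constₛ-1 ⟩
    1ₛ *ₛ f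
      ≈⟨ *ₛ-identityˡ f ⟩
    f                                                        ∎
    where open SetoidReasoning S.setoid

  expTerm-suc : ∀ X l → constₛ (fromℕ R (suc l)) *ₛ expTerm X (suc l) ≋ X *ₛ expTerm X l
  expTerm-suc X l = begin
    constₛ (fromℕ R (suc l)) *ₛ (constₛ (invFact R F (suc l)) *ₛ X ^ₛ suc l)
      ≈⟨ *ₛ-assoc (constₛ _) (constₛ _) (X ^ₛ suc l) ⟨
    constₛ (fromℕ R (suc l)) *ₛ constₛ (invFact R F (suc l)) *ₛ X ^ₛ suc l
      ≈⟨ *ₛ-congʳ (X ^ₛ suc l) (S.trans (constₛ-* _ _) (constₛ-cong (trans (*-comm _ _) (invFact-suc-*-fromℕ l)))) ⟩
    constₛ (invFact R F l) *ₛ (X ^ₛ l *ₛ X)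
      ≈⟨ rotate (constₛ (invFact R F l)) (X ^ₛ l) X ⟩
    X *ₛ (constₛ (invFact R F l) *ₛ X ^ₛ l) ∎
    where
    open SetoidReasoning S.setoid
    open import Algebra.Properties.CommutativeSemigroup S.*-commutativeSemigroup
      renaming (x∙yz≈z∙xy to rotate)

  binomialSum : Series R F → Series R F → ℕ → Series R F
  binomialSum A B K = SΣ.Σ₀ K (λ l → expTerm A l *ₛ expTerm B (K ∸ l))

  binomialSum-suc : ∀ A B K → constₛ (fromℕ R (suc K)) *ₛ binomialSum A B (suc K) ≋ (A +ₛ B) *ₛ binomialSum A B K
  binomialSum-suc A B K = begin
    constₛ (fromℕ R (suc K)) *ₛ binomialSum A B (suc K)
      ≈⟨ SΣ.*-distribˡ-Σ₀ (suc K) (constₛ (fromℕ R (suc K))) _ ⟩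
    SΣ.Σ₀ (suc K) (λ l → constₛ (fromℕ R (suc K)) *ₛ term l)
      ≈⟨ SΣ.Σ₀-cong-≤ (suc K) split ⟩
    SΣ.Σ₀ (suc K) (λ l → weightˡ l +ₛ weightʳ l)
      ≈⟨ SΣ.Σ₀-+ (suc K) weightˡ weightʳ ⟩
    SΣ.Σ₀ (suc K) weightˡ +ₛ SΣ.Σ₀ (suc K) weightʳ
      ≈⟨ S.+-cong weightˡ-sum weightʳ-sum ⟩
    A *ₛ binomialSum A B K +ₛ B *ₛ binomialSum A B K
      ≈⟨ *ₛ-distribʳ (binomialSum A B K) A B ⟨
    (A +ₛ B) *ₛ binomialSum A B K ∎
    where
    open SetoidReasoning S.setoid
    open import Algebra.Properties.CommutativeSemigroup S.*-commutativeSemigroup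
      using (x∙yz≈xy∙z; x∙yz≈y∙xz)
    term weightˡ weightʳ : ℕ → Series R F
    term l    = expTerm A l *ₛ expTerm B (suc K ∸ l)
    weightˡ l = constₛ (fromℕ R l) *ₛ term l
    weightʳ l = constₛ (fromℕ R (suc K ∸ l)) *ₛ term l
    split : ∀ l → l ≤ suc K → constₛ (fromℕ R (suc K)) *ₛ term l ≋ weightˡ l +ₛ weightʳ l
    split l l≤ = S.trans (*ₛ-congʳ (term l) (S.trans
        (constₛ-cong (trans (reflexive (≡.cong (fromℕ R) (≡.sym (ℕₚ.m+[n∸m]≡n l≤)))) (fromℕ-+ l (suc K ∸ l))))
        (S.sym (constₛ-+ _ _))))
      (*ₛ-distribʳ (term l) (constₛ (fromℕ R l)) (constₛ (fromℕ R (suc K ∸ l))))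
      where open IntegerCoefficients R using (fromℕ-+)
    zero-weight : ∀ f → constₛ (fromℕ R 0) *ₛ f ≋ 0ₛ
    zero-weight f = coeffwise λ n → trans (constₛ-*ₛ 0# f n) (zeroˡ _)
    weightˡ-sum : SΣ.Σ₀ (suc K) weightˡ ≋ A *ₛ binomialSum A B K
    weightˡ-sum = begin
      SΣ.Σ₀ (suc K) weightˡ
        ≈⟨ SΣ.Σ₀-head K weightˡ ⟩
      weightˡ 0 +ₛ SΣ.Σ₀ K (λ l → weightˡ (suc l))
        ≈⟨ S.+-congʳ (zero-weight (term 0)) ⟩
      0ₛ +ₛ SΣ.Σ₀ K (λ l → weightˡ (suc l))
        ≈⟨ S.+-identityˡ _ ⟩
      SΣ.Σ₀ K (λ l → weightˡ (suc l))
        ≈⟨ SΣ.Σ₀-cong K (λ l → S.trans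
             (x∙yz≈xy∙z (constₛ _) (expTerm A (suc l)) (expTerm B (K ∸ l)))
             (S.trans (*ₛ-congʳ (expTerm B (K ∸ l)) (expTerm-suc A l))
                      (*ₛ-assoc A (expTerm A l) (expTerm B (K ∸ l))))) ⟩
      SΣ.Σ₀ K (λ l → A *ₛ (expTerm A l *ₛ expTerm B (K ∸ l)))
        ≈⟨ SΣ.*-distribˡ-Σ₀ K A _ ⟨
      A *ₛ binomialSum A B K                                          ∎
    weightʳ-sum : SΣ.Σ₀ (suc K) weightʳ ≋ B *ₛ binomialSum A B K
    weightʳ-sum = begin
      SΣ.Σ₀ K weightʳ +ₛ weightʳ (suc K)
        ≈⟨ S.+-congˡ (S.trans
             (*ₛ-congʳ (term (suc K)) (constₛ-cong (reflexive (≡.cong (fromℕ R) (ℕₚ.n∸n≡0 K)))))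
             (zero-weight (term (suc K)))) ⟩
      SΣ.Σ₀ K weightʳ +ₛ 0ₛ
        ≈⟨ S.+-identityʳ _ ⟩
      SΣ.Σ₀ K weightʳ
        ≈⟨ SΣ.Σ₀-cong-≤ K lower ⟩
      SΣ.Σ₀ K (λ l → B *ₛ (expTerm A l *ₛ expTerm B (K ∸ l)))
        ≈⟨ SΣ.*-distribˡ-Σ₀ K B _ ⟨
      B *ₛ binomialSum A B K                                          ∎
      where
      lower : ∀ l → l ≤ K → weightʳ l ≋ B *ₛ (expTerm A l *ₛ expTerm B (K ∸ l))
      lower l l≤K rewrite ℕₚ.+-∸-assoc 1 l≤K = S.trans
        (x∙yz≈y∙xz (constₛ (fromℕ R (suc (K ∸ l)))) (expTerm A l) (expTerm B (suc (K ∸ l))))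
        (S.trans (*ₛ-congˡ (expTerm A l) (expTerm-suc B (K ∸ l)))
                 (x∙yz≈y∙xz (expTerm A l) B (expTerm B (K ∸ l))))

  expTerm-+ : ∀ A B K → expTerm (A +ₛ B) K ≋ binomialSum A B K
  expTerm-+ A B zero    = S.sym (S.trans (*ₛ-congˡ e e≋1) (*ₛ-identityʳ e))
    where
    e : Series R F
    e = constₛ 1# *ₛ 1ₛ
    e≋1 : e ≋ 1ₛ
    e≋1 = S.trans (*ₛ-identityʳ (constₛ 1#)) constₛ-1
  expTerm-+ A B (suc K) = begin
    expTerm (A +ₛ B) (suc K)
      ≈⟨ constₛ-inv1+-cancel K (expTerm (A +ₛ B) (suc K)) ⟨
    constₛ (inv1+ R F K) *ₛ (constₛ (fromℕ R (suc K)) *ₛ expTerm (A +ₛ B) (suc K))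
      ≈⟨ *ₛ-congˡ (constₛ (inv1+ R F K)) (expTerm-suc (A +ₛ B) K) ⟩
    constₛ (inv1+ R F K) *ₛ ((A +ₛ B) *ₛ expTerm (A +ₛ B) K)
      ≈⟨ *ₛ-congˡ (constₛ (inv1+ R F K)) (*ₛ-congˡ (A +ₛ B) (expTerm-+ A B K)) ⟩
    constₛ (inv1+ R F K) *ₛ ((A +ₛ B) *ₛ binomialSum A B K)
      ≈⟨ *ₛ-congˡ (constₛ (inv1+ R F K)) (binomialSum-suc A B K) ⟨
    constₛ (inv1+ R F K) *ₛ (constₛ (fromℕ R (suc K)) *ₛ binomialSum A B (suc K))
      ≈⟨ constₛ-inv1+-cancel K (binomialSum A B (suc K)) ⟩
    binomialSum A B (suc K) ∎
    where open SetoidReasoning S.setoid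

module Monomials {c ℓ} (R : CommutativeRing c ℓ) (F : IsCharZeroField R) where
  open CommutativeRing R hiding (zero)
  open FiniteSums R
  open PowerSeries R F
  open Derivative R F
  open import Data.Empty using (⊥-elim)
  private
    module S = CommutativeRing seriesRing

  shift : Series R F → Series R F
  shift f zero    = 0#
  shift f (suc j) = f j

  monomial : Carrier → ℕ → Series R F
  monomial d zero    = constₛ d
  monomial d (suc p) = shift (monomial d p)

  shift-cong : ∀ {f g} → f ≋ g → shift f ≋ shift g
  shift-cong f≋g = coeffwise λ { zero → refl ; (suc j) → coeff≈ f≋g j }

  shift-*ₛ : ∀ f g → shift f *ₛ g ≋ shift (f *ₛ g)
  shift-*ₛ f g = coeffwise λ
    { zero    → zeroˡ _
    ; (suc j) → begin
        (shift f *ₛ g) (suc j)                         ≈⟨ *ₛ-coeff (shift f) g (suc j) ⟩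
        Σ₀ (suc j) (λ k → shift f k * g (suc j ∸ k))   ≈⟨ Σ₀-head j _ ⟩
        0# * g (suc j) + Σ₀ j (λ k → f k * g (j ∸ k))  ≈⟨ trans (+-congʳ (zeroˡ _)) (+-identityˡ _) ⟩
        Σ₀ j (λ k → f k * g (j ∸ k))                   ≈⟨ *ₛ-coeff f g j ⟨
        (f *ₛ g) j                                     ∎
    }
    where open SetoidReasoning setoid

  constₛ-*ₛ-monomial : ∀ a d p → constₛ a *ₛ monomial d p ≋ monomial (a * d) p
  constₛ-*ₛ-monomial a d p = coeffwise λ n → trans (constₛ-*ₛ a (monomial d p) n) (scaled p n)
    where
    scaled : ∀ p n → a * monomial d p n ≈ monomial (a * d) p n
    scaled zero    zero    = refl
    scaled zero    (suc n) = zeroʳ a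
    scaled (suc p) zero    = zeroʳ a
    scaled (suc p) (suc n) = scaled p n

  monomial-*ₛ : ∀ d d′ p p′ → monomial d p *ₛ monomial d′ p′ ≋ monomial (d * d′) (p ℕ.+ p′)
  monomial-*ₛ d d′ zero    p′ = constₛ-*ₛ-monomial d d′ p′
  monomial-*ₛ d d′ (suc p) p′ = S.trans (shift-*ₛ (monomial d p) (monomial d′ p′)) (shift-cong (monomial-*ₛ d d′ p p′))

  monomial-^ₛ : ∀ d p l → monomial d p ^ₛ l ≋ monomial (_^ᴿ_ R F d l) (l ℕ.* p)
  monomial-^ₛ d p zero    = coeffwise λ { zero → refl ; (suc n) → refl }
  monomial-^ₛ d p (suc l) = S.trans (*ₛ-congʳ (monomial d p) (monomial-^ₛ d p l))
    (S.trans (monomial-*ₛ (_^ᴿ_ R F d l) d (l ℕ.* p) p) (S.reflexive (≡.cong (monomial _) (ℕₚ.+-comm (l ℕ.* p) p))))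

  monomial-*ₛ-coeff : ∀ d p g n → p ≤ n → (monomial d p *ₛ g) n ≈ d * g (n ∸ p)
  monomial-*ₛ-coeff d zero    g n       _         = constₛ-*ₛ d g n
  monomial-*ₛ-coeff d (suc p) g (suc n) (s≤s p≤n) =
    trans (coeff≈ (shift-*ₛ (monomial d p) g) (suc n)) (monomial-*ₛ-coeff d p g n p≤n)

  monomial-*ₛ-coeff-< : ∀ d p g n → n < p → (monomial d p *ₛ g) n ≈ 0#
  monomial-*ₛ-coeff-< d (suc p) g zero    _         = coeff≈ (shift-*ₛ (monomial d p) g) zero
  monomial-*ₛ-coeff-< d (suc p) g (suc n) (s≤s n<p) =
    trans (coeff≈ (shift-*ₛ (monomial d p) g) (suc n)) (monomial-*ₛ-coeff-< d p g n n<p)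

  monomial-coeff-≡ : ∀ d p → monomial d p p ≈ d
  monomial-coeff-≡ d zero    = refl
  monomial-coeff-≡ d (suc p) = monomial-coeff-≡ d p

  monomial-coeff-≢ : ∀ d p j → j ≢ p → monomial d p j ≈ 0#
  monomial-coeff-≢ d zero    zero    j≢p = ⊥-elim (j≢p ≡.refl)
  monomial-coeff-≢ d zero    (suc j) j≢p = refl
  monomial-coeff-≢ d (suc p) zero    j≢p = refl
  monomial-coeff-≢ d (suc p) (suc j) j≢p = monomial-coeff-≢ d p j (λ j≡p → j≢p (≡.cong suc j≡p))

module BellPolynomials {c ℓ} (R : CommutativeRing c ℓ) (F : IsCharZeroField R) (x : ℕ → CommutativeRing.Carrier R) where
  open CommutativeRing R hiding (zero)
  open FiniteSums R
  open PowerSeries R F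
  open Derivative R F
  open Exponential R F
  open Binomial R F
  open Monomials R F
  open import Data.Bool using (Bool; true; false; if_then_else_; _∧_)
  open import Data.List using (List; []; _∷_; map; concatMap; upTo; applyUpTo; filter; _++_)
  open import Relation.Nullary.Decidable using (T?)
  private
    module S = CommutativeRing seriesRing

  y : ℕ → Carrier
  y j = x j * invFact R F j

  partialSeries : ℕ → ℕ → Series R F
  partialSeries i zero    = 0ₛ
  partialSeries i (suc m) = monomial (y i) i +ₛ partialSeries (suc i) m

  Σᴸ : (List ℕ → Carrier) → List (List ℕ) → Carrier
  Σᴸ H xs = sumList R F (map H xs)

  Σᴸ-cong : ∀ {H H′} xs → (∀ ls → H ls ≈ H′ ls) → Σᴸ H xs ≈ Σᴸ H′ xs
  Σᴸ-cong []       H≈H′ = refl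
  Σᴸ-cong (l ∷ xs) H≈H′ = +-cong (H≈H′ l) (Σᴸ-cong xs H≈H′)

  Σᴸ-++ : ∀ H xs ys → Σᴸ H (xs ++ ys) ≈ Σᴸ H xs + Σᴸ H ys
  Σᴸ-++ H []       ys = sym (+-identityˡ _)
  Σᴸ-++ H (l ∷ xs) ys = trans (+-congˡ (Σᴸ-++ H xs ys)) (sym (+-assoc _ _ _))

  Σᴸ-concatMap : ∀ H (G : ℕ → List (List ℕ)) ls → Σᴸ H (concatMap G ls) ≈ sumList R F (map (λ l → Σᴸ H (G l)) ls)
  Σᴸ-concatMap H G []       = refl
  Σᴸ-concatMap H G (l ∷ ls) = trans (Σᴸ-++ H (G l) (concatMap G ls)) (+-congˡ (Σᴸ-concatMap H G ls))

  Σᴸ-map-∷ : ∀ H l ys → Σᴸ H (map (l ∷_) ys) ≈ Σᴸ (λ ls → H (l ∷ ls)) ys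
  Σᴸ-map-∷ H l []        = refl
  Σᴸ-map-∷ H l (ls ∷ ys) = +-congˡ (Σᴸ-map-∷ H l ys)

  sumList-applyUpTo : ∀ (Q : ℕ → Carrier) f b → sumList R F (map Q (applyUpTo f (suc b))) ≈ Σ₀ b (λ l → Q (f l))
  sumList-applyUpTo Q f zero    = +-identityʳ _
  sumList-applyUpTo Q f (suc b) =
    trans (+-congˡ (sumList-applyUpTo Q (λ l → f (suc l)) b)) (sym (Σ₀-head b (λ l → Q (f l))))

  *-distribˡ-Σᴸ : ∀ a H xs → a * Σᴸ H xs ≈ Σᴸ (λ ls → a * H ls) xs
  *-distribˡ-Σᴸ a H []       = zeroʳ a
  *-distribˡ-Σᴸ a H (l ∷ xs) = trans (distribˡ _ _ _) (+-congˡ (*-distribˡ-Σᴸ a H xs))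

  Σᴸ-zero : ∀ {H} xs → (∀ ls → H ls ≈ 0#) → Σᴸ H xs ≈ 0#
  Σᴸ-zero []       H≈0 = refl
  Σᴸ-zero (l ∷ xs) H≈0 = trans (+-cong (H≈0 l) (Σᴸ-zero xs H≈0)) (+-identityʳ 0#)

  sumList-filter : ∀ (P : List ℕ → Bool) H xs →
                   sumList R F (map H (filter (λ ls → T? (P ls)) xs)) ≈ Σᴸ (λ ls → if P ls then H ls else 0#) xs
  sumList-filter P H []       = refl
  sumList-filter P H (l ∷ xs) with P l
  ... | true  = +-congˡ (sumList-filter P H xs)
  ... | false = trans (sumList-filter P H xs) (sym (+-identityˡ _))

  if-*ʳ : ∀ (b : Bool) a z → (if b then a * z else 0#) ≈ a * (if b then z else 0#)
  if-*ʳ true  a z = refl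
  if-*ʳ false a z = sym (zeroʳ a)

  private
    +-≡ᵇ-∸ : ∀ l s K → l ≤ K → (l ℕ.+ s ℕ.≡ᵇ K) ≡ (s ℕ.≡ᵇ (K ∸ l))
    +-≡ᵇ-∸ zero    s K       _         = ≡.refl
    +-≡ᵇ-∸ (suc l) s (suc K) (s≤s l≤K) = +-≡ᵇ-∸ l s K l≤K

    +-≡ᵇ-> : ∀ l s K → K < l → (l ℕ.+ s ℕ.≡ᵇ K) ≡ false
    +-≡ᵇ-> (suc l) s zero    _         = ≡.refl
    +-≡ᵇ-> (suc l) s (suc K) (s≤s K<l) = +-≡ᵇ-> l s K K<l

  admissibleFrom : ℕ → ℕ → ℕ → List ℕ → Bool
  admissibleFrom i K n ls = (sumℕ R F ls ℕ.≡ᵇ K) ∧ (wsum R F i ls ℕ.≡ᵇ n)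

  admissibleTerm : ℕ → ℕ → ℕ → List ℕ → Carrier
  admissibleTerm i K n ls = if admissibleFrom i K n ls then bellProd R F x i ls else 0#

  bellSum : ℕ → ℕ → ℕ → ℕ → ℕ → Carrier
  bellSum b m i K n = Σᴸ (admissibleTerm i K n) (tuples R F m b)

  leadingFactor : ℕ → ℕ → Carrier
  leadingFactor i l = invFact R F l * _^ᴿ_ R F (y i) l

  admissibleTerm-∷ : ∀ i K n l ls → l ≤ K → i ℕ.* l ≤ n →
                     admissibleTerm i K n (l ∷ ls) ≈ leadingFactor i l * admissibleTerm (suc i) (K ∸ l) (n ∸ i ℕ.* l) ls
  admissibleTerm-∷ i K n l ls l≤K il≤n
    rewrite +-≡ᵇ-∸ l (sumℕ R F ls) K l≤K | +-≡ᵇ-∸ (i ℕ.* l) (wsum R F (suc i) ls) n il≤n =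
    if-*ʳ (admissibleFrom (suc i) (K ∸ l) (n ∸ i ℕ.* l) ls) (leadingFactor i l) (bellProd R F x (suc i) ls)

  admissibleTerm-∷-sum> : ∀ i K n l ls → K < l → admissibleTerm i K n (l ∷ ls) ≈ 0#
  admissibleTerm-∷-sum> i K n l ls K<l rewrite +-≡ᵇ-> l (sumℕ R F ls) K K<l = refl

  admissibleTerm-∷-weight> : ∀ i K n l ls → l ≤ K → n < i ℕ.* l → admissibleTerm i K n (l ∷ ls) ≈ 0#
  admissibleTerm-∷-weight> i K n l ls l≤K n<il
    rewrite +-≡ᵇ-∸ l (sumℕ R F ls) K l≤K | +-≡ᵇ-> (i ℕ.* l) (wsum R F (suc i) ls) n n<il
    with sumℕ R F ls ℕ.≡ᵇ (K ∸ l)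
  ... | true  = refl
  ... | false = refl

  0ₛ-^ₛ-suc : ∀ K n → (0ₛ ^ₛ suc K) n ≈ 0#
  0ₛ-^ₛ-suc K n = trans (*ₛ-coeff (0ₛ ^ₛ K) 0ₛ n) (Σ₀-zero n (λ k _ → zeroʳ _))

  expTerm-monomial : ∀ i l → expTerm (monomial (y i) i) l ≋ monomial (leadingFactor i l) (l ℕ.* i)
  expTerm-monomial i l = S.trans (*ₛ-congˡ (constₛ (invFact R F l)) (monomial-^ₛ (y i) i l))
                                 (constₛ-*ₛ-monomial (invFact R F l) (_^ᴿ_ R F (y i) l) (l ℕ.* i))

  bellSum≈coeff : ∀ b m i K n → K ≤ b → bellSum b m i K n ≈ invFact R F K * (partialSeries i m ^ₛ K) n
  bellSum≈coeff b zero    i zero    zero    _   = trans (+-identityʳ _) (sym (*-identityʳ _))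
  bellSum≈coeff b zero    i zero    (suc n) _   = trans (+-identityʳ _) (sym (zeroʳ _))
  bellSum≈coeff b zero    i (suc K) n       _   =
    trans (+-identityʳ _) (sym (trans (*-congˡ (0ₛ-^ₛ-suc K n)) (zeroʳ _)))
  bellSum≈coeff b (suc m) i K       n       K≤b = begin
    Σᴸ (admissibleTerm i K n) (concatMap (λ l → map (l ∷_) (tuples R F m b)) (upTo (suc b)))
      ≈⟨ Σᴸ-concatMap (admissibleTerm i K n) (λ l → map (l ∷_) (tuples R F m b)) (upTo (suc b)) ⟩
    sumList R F (map (λ l → Σᴸ (admissibleTerm i K n) (map (l ∷_) (tuples R F m b))) (upTo (suc b)))
      ≈⟨ sumList-applyUpTo _ (λ l → l) b ⟩
    Σ₀ b (λ l → Σᴸ (admissibleTerm i K n) (map (l ∷_) (tuples R F m b)))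
      ≈⟨ Σ₀-cong b (λ l → Σᴸ-map-∷ (admissibleTerm i K n) l (tuples R F m b)) ⟩
    Σ₀ b leading
      ≈⟨ Σ₀-extend K b K≤b (λ l K<l _ → Σᴸ-zero (tuples R F m b) (λ ls → admissibleTerm-∷-sum> i K n l ls K<l)) ⟩
    Σ₀ K leading
      ≈⟨ Σ₀-cong-≤ K leading≈ ⟩
    Σ₀ K (λ l → (expTerm A l *ₛ expTerm B (K ∸ l)) n)
      ≈⟨ Σ₀-coeff K _ n ⟨
    binomialSum A B K n
      ≈⟨ coeff≈ (expTerm-+ A B K) n ⟨
    expTerm (A +ₛ B) K n
      ≈⟨ constₛ-*ₛ (invFact R F K) ((A +ₛ B) ^ₛ K) n ⟩
    invFact R F K * ((A +ₛ B) ^ₛ K) n ∎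
    where
    open SetoidReasoning setoid
    A B : Series R F
    A = monomial (y i) i
    B = partialSeries (suc i) m
    leading : ℕ → Carrier
    leading l = Σᴸ (λ ls → admissibleTerm i K n (l ∷ ls)) (tuples R F m b)
    leading≈ : ∀ l → l ≤ K → leading l ≈ (expTerm A l *ₛ expTerm B (K ∸ l)) n
    leading≈ l l≤K with i ℕ.* l ℕ.≤? n
    ... | yes il≤n = begin
      leading l
        ≈⟨ Σᴸ-cong (tuples R F m b) (λ ls → admissibleTerm-∷ i K n l ls l≤K il≤n) ⟩
      Σᴸ (λ ls → leadingFactor i l * admissibleTerm (suc i) (K ∸ l) (n ∸ i ℕ.* l) ls) (tuples R F m b)
        ≈⟨ *-distribˡ-Σᴸ (leadingFactor i l) _ (tuples R F m b) ⟨
      leadingFactor i l * bellSum b m (suc i) (K ∸ l) (n ∸ i ℕ.* l)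
        ≈⟨ *-congˡ (bellSum≈coeff b m (suc i) (K ∸ l) (n ∸ i ℕ.* l) (ℕₚ.≤-trans (ℕₚ.m∸n≤m K l) K≤b)) ⟩
      leadingFactor i l * (invFact R F (K ∸ l) * (B ^ₛ (K ∸ l)) (n ∸ i ℕ.* l))
        ≈⟨ *-congˡ (constₛ-*ₛ (invFact R F (K ∸ l)) (B ^ₛ (K ∸ l)) (n ∸ i ℕ.* l)) ⟨
      leadingFactor i l * expTerm B (K ∸ l) (n ∸ i ℕ.* l)
        ≡⟨ ≡.cong (λ j → leadingFactor i l * expTerm B (K ∸ l) (n ∸ j)) (ℕₚ.*-comm i l) ⟩
      leadingFactor i l * expTerm B (K ∸ l) (n ∸ l ℕ.* i)
        ≈⟨ monomial-*ₛ-coeff (leadingFactor i l) (l ℕ.* i) (expTerm B (K ∸ l)) n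
                             (≡.subst (ℕ._≤ n) (ℕₚ.*-comm i l) il≤n) ⟨
      (monomial (leadingFactor i l) (l ℕ.* i) *ₛ expTerm B (K ∸ l)) n
        ≈⟨ coeff≈ (*ₛ-congʳ (expTerm B (K ∸ l)) (expTerm-monomial i l)) n ⟨
      (expTerm A l *ₛ expTerm B (K ∸ l)) n ∎
    ... | no il≰n = trans
      (Σᴸ-zero (tuples R F m b) (λ ls → admissibleTerm-∷-weight> i K n l ls l≤K (ℕₚ.≰⇒> il≰n)))
      (sym (trans (coeff≈ (*ₛ-congʳ (expTerm B (K ∸ l)) (expTerm-monomial i l)) n)
                  (monomial-*ₛ-coeff-< (leadingFactor i l) (l ℕ.* i) (expTerm B (K ∸ l)) n
                                       (≡.subst (n <_) (ℕₚ.*-comm i l) (ℕₚ.≰⇒> il≰n)))))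

  bellB≈coeff : ∀ n k → bellB R F n k x ≈ fromℕ R (n ℕ.!) * (invFact R F k * (partialSeries 1 (suc (n ∸ k)) ^ₛ k) n)
  bellB≈coeff n k = begin
    bellB R F n k x
      ≈⟨ sumList-filter (admissible R F n k) _ (tuples R F (suc (n ∸ k)) k) ⟩
    Σᴸ (λ ls → if admissibleFrom 1 k n ls then n! * bellProd R F x 1 ls else 0#) (tuples R F (suc (n ∸ k)) k)
      ≈⟨ Σᴸ-cong (tuples R F (suc (n ∸ k)) k) (λ ls → if-*ʳ (admissibleFrom 1 k n ls) n! _) ⟩
    Σᴸ (λ ls → n! * admissibleTerm 1 k n ls) (tuples R F (suc (n ∸ k)) k)
      ≈⟨ *-distribˡ-Σᴸ n! _ (tuples R F (suc (n ∸ k)) k) ⟨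
    n! * bellSum k (suc (n ∸ k)) 1 k n
      ≈⟨ *-congˡ (bellSum≈coeff k (suc (n ∸ k)) 1 k n ℕₚ.≤-refl) ⟩
    n! * (invFact R F k * (partialSeries 1 (suc (n ∸ k)) ^ₛ k) n) ∎
    where
    open SetoidReasoning setoid
    n! : Carrier
    n! = fromℕ R (n ℕ.!)

  partialSeries-below : ∀ i m j → j < i → partialSeries i m j ≈ 0#
  partialSeries-below i zero    j _   = refl
  partialSeries-below i (suc m) j j<i = trans
    (+-cong (monomial-coeff-≢ (y i) i j (ℕₚ.<⇒≢ j<i)) (partialSeries-below (suc i) m j (ℕₚ.m≤n⇒m≤1+n j<i)))
    (+-identityʳ 0#)

  partialSeries-within : ∀ i m j → i ≤ j → j < i ℕ.+ m → partialSeries i m j ≈ y j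
  partialSeries-within i zero    j i≤j j<i+0 =
    ⊥-elim (ℕₚ.<-irrefl ≡.refl (ℕₚ.<-≤-trans j<i+0 (ℕₚ.≤-trans (ℕₚ.≤-reflexive (ℕₚ.+-identityʳ i)) i≤j)))
    where open import Data.Empty using (⊥-elim)
  partialSeries-within i (suc m) j i≤j j<i+1+m with ℕₚ.m≤n⇒m<n∨m≡n i≤j
  ... | inj₂ ≡.refl = trans (+-cong (monomial-coeff-≡ (y i) i) (partialSeries-below (suc i) m i (ℕₚ.n<1+n i)))
                            (+-identityʳ _)
  ... | inj₁ i<j    = trans (+-cong (monomial-coeff-≢ (y i) i j (λ j≡i → ℕₚ.<-irrefl (≡.sym j≡i) i<j))
                                    (partialSeries-within (suc i) m j i<j (≡.subst (j <_) (ℕₚ.+-suc i m) j<i+1+m)))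
                            (+-identityˡ _)

  bellB≈ : ∀ V → V 0 ≈ 0# → (∀ j → 1 ≤ j → V j ≈ y j) → ∀ n k → 1 ≤ k → k ≤ n →
           bellB R F n k x ≈ fromℕ R (n ℕ.!) * (invFact R F k * (V ^ₛ k) n)
  bellB≈ V V₀≈0 V≈y n (suc k) _ k<n =
    trans (bellB≈coeff n (suc k)) (*-congˡ (*-congˡ (sym (x∙y⁻¹≈ε⇒x≈y _ _ same-coeff))))
    where
    open Vanishing R F
    open import Algebra.Properties.Ring ring using (-0#≈0#)
    open import Algebra.Properties.Group +-group using (x∙y⁻¹≈ε⇒x≈y)
    m : ℕ
    m = suc (n ∸ suc k)
    P : Series R F
    P = partialSeries 1 m
    P₀≈0 : P 0 ≈ 0#
    P₀≈0 = partialSeries-below 1 m 0 (s≤s z≤n)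
    V-P≈0 : V +ₛ -ₛ P vanishesBelow suc m
    V-P≈0 zero    _         = trans (+-cong V₀≈0 (trans (-‿cong P₀≈0) -0#≈0#)) (+-identityʳ 0#)
    V-P≈0 (suc j) (s≤s j<m) =
      trans (+-cong (V≈y (suc j) (s≤s z≤n)) (-‿cong (partialSeries-within 1 m (suc j) (s≤s z≤n) (s≤s j<m))))
                                    (-‿inverseʳ _)
    n<1+m+k : n < suc (m ℕ.+ k)
    n<1+m+k = s≤s (ℕₚ.≤-reflexive (≡.sym (≡.trans (≡.sym (ℕₚ.+-suc (n ∸ suc k) k)) (ℕₚ.m∸n+n≡m k<n))))
    same-coeff : (V ^ₛ suc k) n + - (P ^ₛ suc k) n ≈ 0#
    same-coeff = ^ₛ-difference-vanishes V P m V₀≈0 P₀≈0 V-P≈0 k n n<1+m+k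

module BinomialSeries {c ℓ} (R : CommutativeRing c ℓ) (F : IsCharZeroField R)
                      (β : CommutativeRing.Carrier R) (u : Series R F) where
  open CommutativeRing R hiding (zero)
  open PowerSeries R F
  open Derivative R F
  open Vanishing R F
  open Exponential R F using (invFact-suc-*-fromℕ)
  private
    module S  = CommutativeRing seriesRing
    module SΣ = FiniteSums seriesRing

  binomialCoeff : ℕ → Carrier
  binomialCoeff k = fall R F β k * invFact R F k

  -- binomialCoeff (suc k) * (k + 1), the coefficients of the derivative
  derivedCoeff : ℕ → Carrier
  derivedCoeff k = fall R F β (suc k) * invFact R F k

  binomialTrunc : ℕ → Series R F
  binomialTrunc N = SΣ.Σ₀ N (λ k → constₛ (binomialCoeff k) *ₛ u ^ₛ k)

  derivedTrunc : ℕ → Series R F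
  derivedTrunc N = SΣ.Σ₀ N (λ k → constₛ (derivedCoeff k) *ₛ u ^ₛ k)

  D-binomialTrunc : ∀ N → D (binomialTrunc (suc N)) ≋ derivedTrunc N *ₛ D u
  D-binomialTrunc N = S.trans (D-polynomial binomialCoeff u N)
    (*ₛ-congʳ (D u) (SΣ.Σ₀-cong N (λ k → *ₛ-congʳ (u ^ₛ k)
      (constₛ-cong (trans (*-assoc _ _ _) (*-congˡ (invFact-suc-*-fromℕ k)))))))

  derivedCoeff-pascal : ∀ N → derivedCoeff N + derivedCoeff (suc N) ≈ β * binomialCoeff (suc N)
  derivedCoeff-pascal N = begin
    φ * invFact R F N + φ * (β + - fromℕ R (suc N)) * ι
      ≈⟨ +-congʳ (*-congˡ (invFact-suc-*-fromℕ N)) ⟨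
    φ * (ι * fromℕ R (suc N)) + φ * (β + - fromℕ R (suc N)) * ι
      ≈⟨ solve 4 (λ φ ι n β → φ :* (ι :* n) :+ φ :* (β :- n) :* ι := β :* (φ :* ι)) refl φ ι (fromℕ R (suc N)) β ⟩
    β * binomialCoeff (suc N) ∎
    where
    open SetoidReasoning setoid
    open IntegerCoefficients R
    φ ι : Carrier
    φ = fall R F β (suc N)
    ι = invFact R F (suc N)

  1+u-*ₛ-derivedTrunc : ∀ N → (1ₛ +ₛ u) *ₛ derivedTrunc N
                              ≋ constₛ β *ₛ binomialTrunc N +ₛ constₛ (derivedCoeff N) *ₛ u ^ₛ suc N
  1+u-*ₛ-derivedTrunc zero = begin
    (1ₛ +ₛ u) *ₛ (constₛ (derivedCoeff 0) *ₛ 1ₛ)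
      ≈⟨ *ₛ-congˡ (1ₛ +ₛ u) (*ₛ-congʳ 1ₛ (constₛ-cong derivedCoeff₀≈β*binomialCoeff₀)) ⟩
    (1ₛ +ₛ u) *ₛ (constₛ (β * binomialCoeff 0) *ₛ 1ₛ)
      ≈⟨ *ₛ-congˡ (1ₛ +ₛ u) (*ₛ-congʳ 1ₛ (constₛ-* β (binomialCoeff 0))) ⟨
    (1ₛ +ₛ u) *ₛ (constₛ β *ₛ constₛ (binomialCoeff 0) *ₛ 1ₛ)
      ≈⟨ expand (constₛ β) (constₛ (binomialCoeff 0)) u ⟩
    constₛ β *ₛ (constₛ (binomialCoeff 0) *ₛ 1ₛ) +ₛ (constₛ β *ₛ constₛ (binomialCoeff 0)) *ₛ (1ₛ *ₛ u)
      ≈⟨ S.+-congˡ (*ₛ-congʳ (1ₛ *ₛ u) (S.trans (constₛ-cong derivedCoeff₀≈β*binomialCoeff₀)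
                                                (S.sym (constₛ-* β (binomialCoeff 0))))) ⟨
    constₛ β *ₛ binomialTrunc 0 +ₛ constₛ (derivedCoeff 0) *ₛ u ^ₛ 1 ∎
    where
    open SetoidReasoning S.setoid
    derivedCoeff₀≈β*binomialCoeff₀ : derivedCoeff 0 ≈ β * binomialCoeff 0
    derivedCoeff₀≈β*binomialCoeff₀ =
      solve 1 (λ β → (con (+ 1) :* (β :- con (+ 0))) :* con (+ 1) := β :* (con (+ 1) :* con (+ 1))) refl β
      where open IntegerCoefficients R
    expand : ∀ a b u → (1ₛ +ₛ u) *ₛ (a *ₛ b *ₛ 1ₛ) ≋ a *ₛ (b *ₛ 1ₛ) +ₛ (a *ₛ b) *ₛ (1ₛ *ₛ u)
    expand = solve 3 (λ a b u → (con (+ 1) :+ u) :* (a :* b :* con (+ 1))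
                                 := a :* (b :* con (+ 1)) :+ (a :* b) :* (con (+ 1) :* u)) S.refl
      where open IntegerCoefficients seriesRing
  1+u-*ₛ-derivedTrunc (suc N) = begin
    (1ₛ +ₛ u) *ₛ (derivedTrunc N +ₛ d′ *ₛ U)
      ≈⟨ S.distribˡ (1ₛ +ₛ u) (derivedTrunc N) (d′ *ₛ U) ⟩
    (1ₛ +ₛ u) *ₛ derivedTrunc N +ₛ (1ₛ +ₛ u) *ₛ (d′ *ₛ U)
      ≈⟨ S.+-congʳ (1+u-*ₛ-derivedTrunc N) ⟩
    (constₛ β *ₛ binomialTrunc N +ₛ d *ₛ U) +ₛ (1ₛ +ₛ u) *ₛ (d′ *ₛ U)
      ≈⟨ regroup (constₛ β) (binomialTrunc N) d d′ U u ⟩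
    constₛ β *ₛ binomialTrunc N +ₛ (d +ₛ d′) *ₛ U +ₛ d′ *ₛ (U *ₛ u)
      ≈⟨ S.+-congʳ (S.+-congˡ (*ₛ-congʳ U (S.trans (constₛ-+ _ _) (S.trans (constₛ-cong (derivedCoeff-pascal N))
                                                                                     (S.sym (constₛ-* β _)))))) ⟩
    constₛ β *ₛ binomialTrunc N +ₛ (constₛ β *ₛ b′) *ₛ U +ₛ d′ *ₛ (U *ₛ u)
      ≈⟨ S.+-congʳ (factor (constₛ β) (binomialTrunc N) b′ U) ⟩
    constₛ β *ₛ binomialTrunc (suc N) +ₛ constₛ (derivedCoeff (suc N)) *ₛ u ^ₛ suc (suc N) ∎
    where
    open SetoidReasoning S.setoid
    open IntegerCoefficients seriesRing using (solve; _:+_; _:*_; _:=_)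
    U d d′ b′ : Series R F
    U  = u ^ₛ suc N
    d  = constₛ (derivedCoeff N)
    d′ = constₛ (derivedCoeff (suc N))
    b′ = constₛ (binomialCoeff (suc N))
    regroup : ∀ c t d d′ U u → (c *ₛ t +ₛ d *ₛ U) +ₛ (1ₛ +ₛ u) *ₛ (d′ *ₛ U) ≋ c *ₛ t +ₛ (d +ₛ d′) *ₛ U +ₛ d′ *ₛ (U *ₛ u)
    regroup = solve 6 (λ c t d d′ U u → (c :* t :+ d :* U) :+ (con (+ 1) :+ u) :* (d′ :* U)
                                       := c :* t :+ (d :+ d′) :* U :+ d′ :* (U :* u)) S.refl
      where open IntegerCoefficients seriesRing using (con)
    factor : ∀ c t b U → c *ₛ t +ₛ (c *ₛ b) *ₛ U ≋ c *ₛ (t +ₛ b *ₛ U)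
    factor = solve 4 (λ c t b U → c :* t :+ (c :* b) :* U := c :* (t :+ b :* U)) S.refl

  module _ (u₀≈0 : u 0 ≈ 0#) (Q : Series R F) (Q₀≈1 : Q 0 ≈ 1#)
           (ode : (1ₛ +ₛ u) *ₛ D Q ≋ constₛ β *ₛ (Q *ₛ D u)) where

    binomialTrunc-stable : ∀ N i → i ≤ N → binomialTrunc (suc N) i ≈ binomialTrunc N i
    binomialTrunc-stable N i i≤N = trans
      (+-congˡ (vanishesBelow-*ₛˡ (constₛ _) (vanishesBelow-^ₛ u₀≈0 (suc N)) i (s≤s i≤N)))
      (+-identityʳ _)

    remainder-ODE : ∀ n → (1ₛ +ₛ u) *ₛ D (Q +ₛ -ₛ binomialTrunc (suc n))
                          ≋ constₛ β *ₛ ((Q +ₛ -ₛ binomialTrunc n) *ₛ D u)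
                            +ₛ -ₛ (constₛ (derivedCoeff n) *ₛ u ^ₛ suc n *ₛ D u)
    remainder-ODE n = begin
      q *ₛ D (Q +ₛ -ₛ T (suc n))
        ≈⟨ *ₛ-congˡ q (S.trans (D-+ Q (-ₛ T (suc n))) (S.+-congˡ (D-neg (T (suc n))))) ⟩
      q *ₛ (D Q +ₛ -ₛ D (T (suc n)))
        ≈⟨ distrib-minus q (D Q) (D (T (suc n))) ⟩
      q *ₛ D Q +ₛ -ₛ (q *ₛ D (T (suc n)))
        ≈⟨ S.+-cong ode (S.-‿cong (*ₛ-congˡ q (D-binomialTrunc n))) ⟩
      constₛ β *ₛ (Q *ₛ D u) +ₛ -ₛ (q *ₛ (derivedTrunc n *ₛ D u))
        ≈⟨ S.+-congˡ (S.-‿cong (S.trans (S.sym (*ₛ-assoc q (derivedTrunc n) (D u)))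
                                        (*ₛ-congʳ (D u) (1+u-*ₛ-derivedTrunc n)))) ⟩
      constₛ β *ₛ (Q *ₛ D u) +ₛ -ₛ ((constₛ β *ₛ T n +ₛ constₛ (derivedCoeff n) *ₛ u ^ₛ suc n) *ₛ D u)
        ≈⟨ regroup (constₛ β) Q (D u) (T n) (constₛ (derivedCoeff n) *ₛ u ^ₛ suc n) ⟩
      constₛ β *ₛ ((Q +ₛ -ₛ T n) *ₛ D u) +ₛ -ₛ (constₛ (derivedCoeff n) *ₛ u ^ₛ suc n *ₛ D u) ∎
      where
      open SetoidReasoning S.setoid
      open IntegerCoefficients seriesRing using (solve; _:+_; _:-_; :-_; _:*_; _:=_)
      q : Series R F
      q = 1ₛ +ₛ u
      T : ℕ → Series R F
      T = binomialTrunc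
      distrib-minus : ∀ x y z → x *ₛ (y +ₛ -ₛ z) ≋ x *ₛ y +ₛ -ₛ (x *ₛ z)
      distrib-minus = solve 3 (λ x y z → x :* (y :- z) := x :* y :- x :* z) S.refl
      regroup : ∀ b P du t r → b *ₛ (P *ₛ du) +ₛ -ₛ ((b *ₛ t +ₛ r) *ₛ du) ≋ b *ₛ ((P +ₛ -ₛ t) *ₛ du) +ₛ -ₛ (r *ₛ du)
      regroup = solve 5 (λ b P du t r → b :* (P :* du) :- (b :* t :+ r) :* du
                                         := b :* ((P :- t) :* du) :- r :* du) S.refl

    approximates : ∀ n → Q +ₛ -ₛ binomialTrunc n vanishesBelow suc n
    approximates zero    zero    _        =
      trans (+-cong Q₀≈1 (-‿cong (trans (*-identityʳ _) (*-identityʳ _)))) (-‿inverseʳ 1#)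
    approximates zero    (suc i) (s≤s ())
    approximates (suc n) = vanishesBelow-suc below top
      where
      below : Q +ₛ -ₛ binomialTrunc (suc n) vanishesBelow suc n
      below j j<1+n = trans (+-congˡ (-‿cong (binomialTrunc-stable n j (ℕₚ.≤-pred j<1+n)))) (approximates n j j<1+n)
      top : (Q +ₛ -ₛ binomialTrunc (suc n)) (suc n) ≈ 0#
      top = next-coeff-vanishes u (Q +ₛ -ₛ binomialTrunc (suc n)) n u₀≈0 below
        (trans (coeff≈ (remainder-ODE n) n)
               (vanishesBelow-+ₛ
                 (vanishesBelow-*ₛˡ (constₛ β) (vanishesBelow-*ₛʳ (D u) (approximates n)))
                 (vanishesBelow--ₛ (vanishesBelow-*ₛʳ (D u)
                   (vanishesBelow-*ₛˡ (constₛ _) (vanishesBelow-^ₛ u₀≈0 (suc n)))))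
                 n ℕₚ.≤-refl))

    binomial-ODE-unique : ∀ n → Q n ≈ binomialTrunc n n
    binomial-ODE-unique n = x∙y⁻¹≈ε⇒x≈y (Q n) (binomialTrunc n n) (approximates n n ℕₚ.≤-refl)
      where open import Algebra.Properties.Group +-group using (x∙y⁻¹≈ε⇒x≈y)

module DegenerateEuler {c ℓ} (R : CommutativeRing c ℓ) (F : IsCharZeroField R) (lam α : CommutativeRing.Carrier R) where
  open CommutativeRing R hiding (zero)
  open FiniteSums R
  open PowerSeries R F
  open Derivative R F
  open Exponential R F using (D-expS)
  open Logarithm R F using (D-logS)
  open Reciprocal R F using (*ₛ-recipS)
  open import Algebra.Properties.Ring ring using (-0#≈0#)
  private
    module S = CommutativeRing seriesRing

  half : Carrier
  half = inv1+ R F 1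

  e f V u P : Series R F
  e = eλ R F lam
  f = twoOverEPlus1 R F lam
  V = _⊖_ R F e 1ₛ
  u = constₛ half *ₛ V
  P = powC R F f α

  e₀≈1 : e 0 ≈ 1#
  e₀≈1 = *-identityˡ 1#

  V₀≈0 : V 0 ≈ 0#
  V₀≈0 = trans (+-congʳ e₀≈1) (-‿inverseʳ 1#)

  u₀≈0 : u 0 ≈ 0#
  u₀≈0 = trans (*-congˡ V₀≈0) (zeroʳ half)

  f₀≈1 : f 0 ≈ 1#
  f₀≈1 = fromℕ-suc-*-inv1+ 1

  f-*ₛ-1+u : f *ₛ (1ₛ +ₛ u) ≋ 1ₛ
  f-*ₛ-1+u = begin
    f *ₛ (1ₛ +ₛ u)
      ≈⟨ *ₛ-congʳ (1ₛ +ₛ u) (scale≋constₛ-*ₛ (fromℕ R 2) g) ⟩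
    (two *ₛ g) *ₛ (1ₛ +ₛ constₛ half *ₛ V)
      ≈⟨ expand two g (constₛ half) V ⟩
    g *ₛ (two +ₛ (two *ₛ constₛ half) *ₛ V)
      ≈⟨ *ₛ-congˡ g (S.+-congˡ {two} (*ₛ-congʳ V two*half≋1)) ⟩
    g *ₛ (two +ₛ 1ₛ *ₛ V)
      ≈⟨ *ₛ-congˡ g (S.trans (S.+-congˡ {two} (*ₛ-identityˡ V)) two+V≋e+1) ⟩
    g *ₛ (e +ₛ 1ₛ)
      ≈⟨ *ₛ-comm g (e +ₛ 1ₛ) ⟩
    (e +ₛ 1ₛ) *ₛ g
      ≈⟨ *ₛ-recipS (e +ₛ 1ₛ) half (trans (*-congʳ e₀+1≈2) f₀≈1) ⟩
    1ₛ                                               ∎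
    where
    open SetoidReasoning S.setoid
    g two : Series R F
    g   = recipS R F (e +ₛ 1ₛ) half
    two = constₛ (fromℕ R 2)
    e₀+1≈2 : e 0 + 1# ≈ fromℕ R 2
    e₀+1≈2 = trans (+-congʳ e₀≈1) (+-congˡ (sym (+-identityʳ 1#)))
    two*half≋1 : two *ₛ constₛ half ≋ 1ₛ
    two*half≋1 = S.trans (constₛ-* (fromℕ R 2) half) (S.trans (constₛ-cong f₀≈1) constₛ-1)
    two+V≋e+1 : two +ₛ V ≋ e +ₛ 1ₛ
    two+V≋e+1 = coeffwise λ
      { zero    → trans (+-congʳ (fromℕ≈×1 2))
                        (solve 1 (λ x → con (+ 2) :+ (x :- con (+ 1)) := x :+ con (+ 1)) refl (e 0))
      ; (suc n) → trans (+-identityˡ _) (+-congˡ -0#≈0#)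
      }
      where open IntegerCoefficients R
    expand : ∀ x y z w → (x *ₛ y) *ₛ (1ₛ +ₛ z *ₛ w) ≋ y *ₛ (x +ₛ (x *ₛ z) *ₛ w)
    expand = solve 4 (λ x y z w → (x :* y) :* (con (+ 1) :+ z :* w) := y :* (x :+ (x :* z) :* w)) S.refl
      where open IntegerCoefficients seriesRing

  1+u-*ₛ-D-logS : (1ₛ +ₛ u) *ₛ D (logS R F f) ≋ -ₛ D u
  1+u-*ₛ-D-logS = begin
    q *ₛ L′                    ≈⟨ *ₛ-congˡ q (*ₛ-identityˡ L′) ⟨
    q *ₛ (1ₛ *ₛ L′)            ≈⟨ *ₛ-congˡ q (*ₛ-congʳ L′ f-*ₛ-1+u) ⟨
    q *ₛ ((f *ₛ q) *ₛ L′)      ≈⟨ reassoc q f L′ ⟩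
    (q *ₛ q) *ₛ (f *ₛ L′)      ≈⟨ *ₛ-congˡ (q *ₛ q) (D-logS f f₀≈1) ⟩
    (q *ₛ q) *ₛ D f            ≈⟨ reassoc′ q (D f) ⟩
    q *ₛ (D f *ₛ q)            ≈⟨ *ₛ-congˡ q Df-*ₛ-q ⟩
    q *ₛ -ₛ (f *ₛ D u)         ≈⟨ reassoc″ q f (D u) ⟩
    -ₛ ((f *ₛ q) *ₛ D u)       ≈⟨ S.-‿cong (S.trans (*ₛ-congʳ (D u) f-*ₛ-1+u) (*ₛ-identityˡ (D u))) ⟩
    -ₛ D u                     ∎
    where
    open SetoidReasoning S.setoid
    open IntegerCoefficients seriesRing
    q L′ : Series R F
    q  = 1ₛ +ₛ u
    L′ = D (logS R F f)
    -- differentiate f (1 + u) = 1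
    Df-*ₛ-q : D f *ₛ q ≋ -ₛ (f *ₛ D u)
    Df-*ₛ-q = begin
      D f *ₛ q
        ≈⟨ S.+-identityʳ _ ⟨
      D f *ₛ q +ₛ 0ₛ
        ≈⟨ S.+-congˡ (S.-‿inverseˡ (f *ₛ D u)) ⟨
      D f *ₛ q +ₛ (-ₛ (f *ₛ D u) +ₛ f *ₛ D u)
        ≈⟨ move (D f *ₛ q) (f *ₛ D u) ⟩
      -ₛ (f *ₛ D u) +ₛ (D f *ₛ q +ₛ f *ₛ D u)
        ≈⟨ S.+-congˡ (S.trans (S.+-congˡ {D f *ₛ q} (*ₛ-congˡ f D-1+u))
                              (S.trans (S.sym (D-*ₛ f q)) (S.trans (D-cong f-*ₛ-1+u) D-1))) ⟩
      -ₛ (f *ₛ D u) +ₛ 0ₛ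
        ≈⟨ S.+-identityʳ _ ⟩
      -ₛ (f *ₛ D u)                             ∎
      where
      D-1+u : D u ≋ D q
      D-1+u = S.sym (S.trans (D-+ 1ₛ u) (S.trans (S.+-congʳ D-1) (S.+-identityˡ (D u))))
      move : ∀ a b → a +ₛ (-ₛ b +ₛ b) ≋ -ₛ b +ₛ (a +ₛ b)
      move = solve 2 (λ a b → a :+ (:- b :+ b) := :- b :+ (a :+ b)) S.refl
    reassoc : ∀ x y z → x *ₛ ((y *ₛ x) *ₛ z) ≋ (x *ₛ x) *ₛ (y *ₛ z)
    reassoc = solve 3 (λ x y z → x :* ((y :* x) :* z) := (x :* x) :* (y :* z)) S.refl
    reassoc′ : ∀ x y → (x *ₛ x) *ₛ y ≋ x *ₛ (y *ₛ x)
    reassoc′ = solve 2 (λ x y → (x :* x) :* y := x :* (y :* x)) S.refl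
    reassoc″ : ∀ x y z → x *ₛ -ₛ (y *ₛ z) ≋ -ₛ ((y *ₛ x) *ₛ z)
    reassoc″ = solve 3 (λ x y z → x :* (:- (y :* z)) := :- ((y :* x) :* z)) S.refl

  power-ODE : (1ₛ +ₛ u) *ₛ D P ≋ constₛ (- α) *ₛ (P *ₛ D u)
  power-ODE = begin
    q *ₛ D P
      ≈⟨ *ₛ-congˡ q (D-expS (scale R F α (logS R F f)) (zeroʳ α)) ⟩
    q *ₛ (P *ₛ D (scale R F α (logS R F f)))
      ≈⟨ *ₛ-congˡ q (*ₛ-congˡ P (S.trans (D-cong (scale≋constₛ-*ₛ α (logS R F f))) (D-constₛ-*ₛ α (logS R F f)))) ⟩
    q *ₛ (P *ₛ (constₛ α *ₛ L′))
      ≈⟨ reassoc q P (constₛ α) L′ ⟩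
    (constₛ α *ₛ P) *ₛ (q *ₛ L′)
      ≈⟨ *ₛ-congˡ (constₛ α *ₛ P) 1+u-*ₛ-D-logS ⟩
    (constₛ α *ₛ P) *ₛ -ₛ D u
      ≈⟨ reassoc′ (constₛ α) P (D u) ⟩
    -ₛ constₛ α *ₛ (P *ₛ D u)
      ≈⟨ *ₛ-congʳ (P *ₛ D u) (constₛ-neg α) ⟩
    constₛ (- α) *ₛ (P *ₛ D u)               ∎
    where
    open SetoidReasoning S.setoid
    open IntegerCoefficients seriesRing
    q L′ : Series R F
    q  = 1ₛ +ₛ u
    L′ = D (logS R F f)
    reassoc : ∀ x y z w → x *ₛ (y *ₛ (z *ₛ w)) ≋ (z *ₛ y) *ₛ (x *ₛ w)
    reassoc = solve 4 (λ x y z w → x :* (y :* (z :* w)) := (z :* y) :* (x :* w)) S.refl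
    reassoc′ : ∀ x y z → (x *ₛ y) *ₛ (-ₛ z) ≋ -ₛ x *ₛ (y *ₛ z)
    reassoc′ = solve 3 (λ x y z → (x :* y) :* (:- z) := :- x :* (y :* z)) S.refl

  open BinomialSeries R F (- α) u using (binomialCoeff; binomialTrunc; binomial-ODE-unique)

  P≈binomialTrunc : ∀ n → P n ≈ binomialTrunc n n
  P≈binomialTrunc = binomial-ODE-unique u₀≈0 P (*-identityˡ 1#) power-ODE

  u^k-coeff : ∀ k n → (u ^ₛ k) n ≈ _^ᴿ_ R F half k * (V ^ₛ k) n
  u^k-coeff k n = trans (coeff≈ (^ₛ-constₛ-*ₛ half V k) n) (constₛ-*ₛ _ (V ^ₛ k) n)

  degEuler≈Stirling : ∀ n → 1 ≤ n →
    degEuler R F lam α n ≈ sum1To R F n (λ k → fall R F (- α) k * _^ᴿ_ R F half k * S2λ R F lam n k)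
  degEuler≈Stirling n@(suc _) _ = begin
    n! * P n
      ≈⟨ *-congˡ (trans (P≈binomialTrunc n) (Σ₀-coeff n _ n)) ⟩
    n! * Σ₀ n (λ k → (constₛ (binomialCoeff k) *ₛ u ^ₛ k) n)
      ≈⟨ *-congˡ (Σ₀-cong n (λ k → trans (constₛ-*ₛ _ (u ^ₛ k) n) (*-congˡ (u^k-coeff k n)))) ⟩
    n! * Σ₀ n (λ k → binomialCoeff k * (_^ᴿ_ R F half k * (V ^ₛ k) n))
      ≈⟨ *-distribˡ-Σ₀ n n! _ ⟩
    Σ₀ n (λ k → n! * (binomialCoeff k * (_^ᴿ_ R F half k * (V ^ₛ k) n)))
      ≈⟨ Σ₀≈head+Σ₁ n _ ⟩
    n! * (binomialCoeff 0 * (1# * 0#)) + Σ₁ n (λ k → n! * (binomialCoeff k * (_^ᴿ_ R F half k * (V ^ₛ k) n)))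
      ≈⟨ +-cong (trans (*-congˡ (trans (*-congˡ (zeroʳ 1#)) (zeroʳ _))) (zeroʳ _))
                (Σ₁-cong-< n (λ k _ → rearrange n! (fall R F (- α) (suc k)) (invFact R F (suc k)) _ _)) ⟩
    0# + Σ₁ n (λ k → fall R F (- α) k * _^ᴿ_ R F half k * S2λ R F lam n k)
      ≈⟨ +-identityˡ _ ⟩
    Σ₁ n (λ k → fall R F (- α) k * _^ᴿ_ R F half k * S2λ R F lam n k)
      ≡⟨ sum1To≡Σ₁ n _ ⟨
    sum1To R F n (λ k → fall R F (- α) k * _^ᴿ_ R F half k * S2λ R F lam n k) ∎
    where
    open SetoidReasoning setoid
    n! : Carrier
    n! = fromℕ R (n ℕ.!)
    rearrange : ∀ t x y z w → t * ((x * y) * (z * w)) ≈ x * z * (t * (y * w))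
    rearrange = solve 5 (λ t x y z w → t :* ((x :* y) :* (z :* w)) := x :* z :* (t :* (y :* w))) refl
      where open IntegerCoefficients R

  S2λ≈bellB : ∀ n k → 1 ≤ k → k ≤ n → S2λ R F lam n k ≈ bellB R F n k (degFall R F 1# lam)
  S2λ≈bellB n k 1≤k k≤n = sym (bellB≈ V V₀≈0 V≈e n k 1≤k k≤n)
    where
    open BellPolynomials R F (degFall R F 1# lam) using (bellB≈)
    V≈e : ∀ j → 1 ≤ j → V j ≈ e j
    V≈e (suc j) _ = trans (+-congˡ -0#≈0#) (+-identityʳ _)

  degEuler≈Bell : ∀ n → 1 ≤ n →
    degEuler R F lam α n ≈ sum1To R F n (λ k → fall R F (- α) k * _^ᴿ_ R F half k * bellB R F n k (degFall R F 1# lam))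
  degEuler≈Bell n 1≤n = begin
    degEuler R F lam α n
      ≈⟨ degEuler≈Stirling n 1≤n ⟩
    sum1To R F n (λ k → fall R F (- α) k * _^ᴿ_ R F half k * S2λ R F lam n k)
      ≡⟨ sum1To≡Σ₁ n _ ⟩
    Σ₁ n (λ k → fall R F (- α) k * _^ᴿ_ R F half k * S2λ R F lam n k)
      ≈⟨ Σ₁-cong-< n (λ k k<n → *-congˡ (S2λ≈bellB n (suc k) (s≤s z≤n) k<n)) ⟩
    Σ₁ n (λ k → fall R F (- α) k * _^ᴿ_ R F half k * bellB R F n k (degFall R F 1# lam))
      ≡⟨ sum1To≡Σ₁ n _ ⟨
    sum1To R F n (λ k → fall R F (- α) k * _^ᴿ_ R F half k * bellB R F n k (degFall R F 1# lam)) ∎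
    where open SetoidReasoning setoid

theorem6 : ∀ {c ℓ : Level} (R : CommutativeRing c ℓ) (F : IsCharZeroField R)
           → let open CommutativeRing R in
           (lam α : Carrier) → ¬ (lam ≈ 0#) → ¬ (α ≈ 0#)
           → (n : ℕ) → 1 ≤ n
           → (degEuler R F lam α n
                ≈ sum1To R F n (λ k → fall R F (- α) k * _^ᴿ_ R F (inv1+ R F 1) k
                                       * bellB R F n k (λ i → degFall R F 1# lam i)))
             × (degEuler R F lam α n
                ≈ sum1To R F n (λ k → fall R F (- α) k * _^ᴿ_ R F (inv1+ R F 1) k
                                       * S2λ R F lam n k))
-- The identities hold for every λ and α.
theorem6 R F lam α _ _ n 1≤n = degEuler≈Bell n 1≤n , degEuler≈Stirling n 1≤n
  where open DegenerateEuler R F lam α
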